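{- Let $r(x)=\sum_{n\ge 0}x^{2^n-1}$ and $h_n=H_n(1-xr(x))$. For $y\in\mathbb{Z}$ let $y^+=y+1$ if $y>0$ and $y^+=y-1$ if $y\le 0$. Then $h_0=h_1=1$, $h_2=-2$, and for all $n\ge 0$: $h_{8n}=h_{4n}$, $h_{8n+1}=h_{4n+1}$, $h_{8n+2}=h_{4n+2}$, $h_{8n+3}=-(h_{4n+2})^+$, $h_{8n+4}=-h_{4n+2}$, $h_{8n+5}=-h_{4n+3}$, $h_{8n+6}=(h_{4n+3})^+$, $h_{8n+7}=h_{4n+3}$.
   Context: For a power series $f(x)=\sum_{i\ge 0}a_ix^i$ and $n\ge 1$, $H_n(f)=\det(a_{i+j})_{0\le i,j\le n-1}$, $H_0(f)=1$. -}

module Defs where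

open import Data.Nat as ℕ using (ℕ; zero; suc; _^_)
open import Data.Integer as ℤ using (ℤ; +_; -_; _+_; _*_; 1ℤ; 0ℤ; _≤ᵇ_; _-_)
open import Data.Fin using (Fin; zero; suc; toℕ; punchIn)
open import Data.Bool using (Bool; true; false; if_then_else_)
open import Data.Product using (∃)
open import Relation.Binary.PropositionalEquality using (_≡_)

∑ : ∀ {n} → (Fin n → ℤ) → ℤ
∑ {zero}  f = 0ℤ
∑ {suc n} f = f zero + ∑ (λ i → f (suc i))

sgn : ℕ → ℤ
sgn zero          = 1ℤ
sgn (suc zero)    = - 1ℤ
sgn (suc (suc k)) = sgn k

det : ∀ n → (Fin n → Fin n → ℤ) → ℤ
det zero    M = 1ℤ
det (suc n) M = ∑ (λ j → sgn (toℕ j) * (M zero j * det n (λ r c → M (suc r) (punchIn j c))))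

H : ℕ → (ℕ → ℤ) → ℤ
H n a = det n (λ i j → a (toℕ i ℕ.+ toℕ j))

-- Coefficients of r(x) = Σ_{n≥0} x^(2^n - 1): coefficient of x^k is 1 iff
-- k = 2^m - 1 for some m (decided by bounded search; m ≤ k+1 suffices).
isPow2 : ℕ → Bool
isPow2 k = search (suc k)
  where
  search : ℕ → Bool
  search zero    = false
  search (suc m) = if (2 ^ m) ℕ.≡ᵇ k then true else search m

rCoeff : ℕ → ℤ
rCoeff k = if isPow2 (suc k) then 1ℤ else 0ℤ

f : ℕ → ℤ
f zero    = 1ℤ
f (suc k) = - rCoeff k

h : ℕ → ℤ
h n = H n f

_⁺ : ℤ → ℤ
y ⁺ = if y ≤ᵇ 0ℤ then y - 1ℤ else y + 1ℤ

{-# OPTIONS --safe #-}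
-- The coefficients of 1 - x r(x) satisfy a₀ = 1, a₁ = -1, a₂ₖ = aₖ and a₂ₖ₊₃ = 0.  Write
-- Hₛ(n) = det (a_{s+i+j})_{i,j<n}, so that hₙ = H₀(n).  Listing the even indices before the
-- odd ones, for rows and columns alike, cuts the matrix of Hₛ(n) into blocks which are again
-- shifted Hankel matrices of a, except for the entries a₁ in the first rows when s ≤ 1; these
-- are split off by linearity of the determinant in a row.  This gives
--   H₂(2m) = H₁(m) H₂(m),           H₂(2m+1) = H₁(m+1) H₂(m),
--   H₃(2m) = (-1)ᵐ H₂(m)²,          H₃(2m+1) = 0,
--   H₁(2m+1) = -(-1)ᵐ H₂(m)²,       H₁(2m+2) = (-1)ᵐ⁺¹ H₁(m+1)²,
--   H₀(2m+2) = H₀(m+1) H₁(m+1) - H₂(m) H₃(m),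
--   H₀(2m+3) = H₀(m+2) H₁(m+1) - H₂(m+1) H₃(m).
-- Hence H₁ and H₂ only take the values ±1, H₁ and H₃(2m) are explicit signs, and by
-- induction H₀(k+1) H₂(k) > 0.  Unfolding the H₀ recurrences from 8n + j down to 4n + j′
-- gives the eight identities, the positivity deciding which of y ± 1 is y⁺.
module Submission where

module Minors where

  open import Data.Nat as ℕ using (ℕ; zero; suc; _≤_; _<_; s≤s; _≡ᵇ_)
  import Data.Nat.Properties as ℕₚ
  open import Data.Integer using (ℤ; -_; _+_; _*_; _-_; 0ℤ; 1ℤ)
  import Data.Integer.Properties as ℤₚ
  open import Algebra.Properties.AbelianGroup ℤₚ.+-0-abelianGroup using () renaming (inverseˡ-unique to +-inverseˡ-unique)
  open import Data.Integer.Tactic.RingSolver using (solve-∀)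
  open import Data.Bool using (Bool; true; false; if_then_else_; not; T)
  open import Data.Fin using (Fin; zero; suc; toℕ; punchIn)
  open import Data.List using (List; []; _∷_; _++_; length; map; tabulate; filterᵇ)
  open import Data.List.Properties using (++-assoc; ++-identityʳ)
  open import Data.List.Membership.Propositional using (_∈_)
  open import Data.List.Relation.Unary.Any using (here; there)
  open import Data.List.Relation.Binary.Permutation.Propositional using (_↭_; prep; ↭-refl; ↭-trans; ↭-sym)
  open import Data.List.Relation.Binary.Permutation.Propositional.Properties using (↭-length; ++⁺ˡ; shift)
  open import Relation.Binary.PropositionalEquality
  open import Data.Empty using (⊥-elim)
  open import Data.Unit using (tt)
  open import Defs using (sgn; ∑; det)

  sgn-suc : ∀ n → sgn (suc n) ≡ - sgn n
  sgn-suc zero          = refl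
  sgn-suc (suc zero)    = refl
  sgn-suc (suc (suc n)) = sgn-suc n

  sgn-+ : ∀ m n → sgn (m ℕ.+ n) ≡ sgn m * sgn n
  sgn-+ zero          n = sym (ℤₚ.*-identityˡ (sgn n))
  sgn-+ (suc zero)    n = trans (sgn-suc n) (sym (ℤₚ.-1*i≡-i (sgn n)))
  sgn-+ (suc (suc m)) n = sgn-+ m n

  sgn-square : ∀ n → sgn n * sgn n ≡ 1ℤ
  sgn-square zero          = refl
  sgn-square (suc zero)    = refl
  sgn-square (suc (suc n)) = sgn-square n

  sgn-*-suc : ∀ m n → sgn (m ℕ.* suc n) ≡ sgn m * sgn (m ℕ.* n)
  sgn-*-suc m n = trans (cong sgn (ℕₚ.*-suc m n)) (sgn-+ m (m ℕ.* n))

  sgn-*-neg : ∀ n x → sgn n * - x ≡ sgn (suc n) * x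
  sgn-*-neg n x = trans (sym (ℤₚ.neg-distribʳ-* (sgn n) x))
                        (trans (ℤₚ.neg-distribˡ-* (sgn n) x) (cong (_* x) (sym (sgn-suc n))))

  Matrix : Set
  Matrix = ℕ → ℕ → ℤ

  -- alt g (c₀ ∷ … ∷ cₖ) = Σᵢ (-1)ⁱ g cᵢ (c₀ ∷ … ∷ cₖ without cᵢ)
  alt : (ℕ → List ℕ → ℤ) → List ℕ → ℤ
  alt g []       = 0ℤ
  alt g (c ∷ cs) = g c cs - alt (λ c′ rest → g c′ (c ∷ rest)) cs

  -- The determinant of the submatrix of M on the rows rs and the columns cs,
  -- expanded along its first row.  With fewer columns than rows it is 0.
  minor : Matrix → List ℕ → List ℕ → ℤ
  minor M []       cs = 1ℤ
  minor M (r ∷ rs) cs = alt (λ c rest → M r c * minor M rs rest) cs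

  data Drop (x : ℕ) : List ℕ → List ℕ → Set where
    here  : ∀ {xs} → Drop x (x ∷ xs) xs
    there : ∀ {y xs rest} → Drop x xs rest → Drop x (y ∷ xs) (y ∷ rest)

  Drop⇒∈ : ∀ {x xs rest} → Drop x xs rest → x ∈ xs
  Drop⇒∈ here      = here refl
  Drop⇒∈ (there d) = there (Drop⇒∈ d)

  Drop-⊆ : ∀ {x xs rest y} → Drop x xs rest → y ∈ rest → y ∈ xs
  Drop-⊆ here      i         = there i
  Drop-⊆ (there d) (here p)  = here p
  Drop-⊆ (there d) (there i) = there (Drop-⊆ d i)

  Drop-length : ∀ {x xs rest} → Drop x xs rest → length xs ≡ suc (length rest)
  Drop-length here      = refl
  Drop-length (there d) = cong suc (Drop-length d)

  alt-cong : ∀ {g g′} cs → (∀ c rest → Drop c cs rest → g c rest ≡ g′ c rest) →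
             alt g cs ≡ alt g′ cs
  alt-cong []       eq = refl
  alt-cong (x ∷ xs) eq = cong₂ _-_ (eq x xs here) (alt-cong xs (λ c rest d → eq c (x ∷ rest) (there d)))

  alt-zero : ∀ {g} cs → (∀ c rest → Drop c cs rest → g c rest ≡ 0ℤ) → alt g cs ≡ 0ℤ
  alt-zero []       eq = refl
  alt-zero (x ∷ xs) eq = cong₂ _-_ (eq x xs here) (alt-zero xs (λ c rest d → eq c (x ∷ rest) (there d)))

  alt-+ : ∀ g g′ cs → alt (λ c rest → g c rest + g′ c rest) cs ≡ alt g cs + alt g′ cs
  alt-+ g g′ []       = refl
  alt-+ g g′ (x ∷ xs) = begin
    g x xs + g′ x xs - alt (λ c r → g c (x ∷ r) + g′ c (x ∷ r)) xs
      ≡⟨ cong (_-_ (g x xs + g′ x xs)) (alt-+ (λ c r → g c (x ∷ r)) (λ c r → g′ c (x ∷ r)) xs) ⟩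
    g x xs + g′ x xs - (alt (λ c r → g c (x ∷ r)) xs + alt (λ c r → g′ c (x ∷ r)) xs)
      ≡⟨ interchange (g x xs) (g′ x xs) _ _ ⟩
    (g x xs - alt (λ c r → g c (x ∷ r)) xs) + (g′ x xs - alt (λ c r → g′ c (x ∷ r)) xs) ∎
    where
    open ≡-Reasoning
    interchange : ∀ (a b A B : ℤ) → a + b - (A + B) ≡ (a - A) + (b - B)
    interchange = solve-∀

  alt-*ˡ : ∀ k g cs → alt (λ c rest → k * g c rest) cs ≡ k * alt g cs
  alt-*ˡ k g []       = sym (ℤₚ.*-zeroʳ k)
  alt-*ˡ k g (x ∷ xs) =
    trans (cong (_-_ (k * g x xs)) (alt-*ˡ k (λ c r → g c (x ∷ r)) xs))
          (distrib k (g x xs) (alt (λ c r → g c (x ∷ r)) xs))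
    where
    distrib : ∀ (k a b : ℤ) → k * a - k * b ≡ k * (a - b)
    distrib = solve-∀

  alt-*ʳ : ∀ k g cs → alt (λ c rest → g c rest * k) cs ≡ alt g cs * k
  alt-*ʳ k g cs = trans (alt-cong cs (λ c rest _ → ℤₚ.*-comm (g c rest) k))
                        (trans (alt-*ˡ k g cs) (ℤₚ.*-comm k (alt g cs)))

  alt-neg : ∀ g cs → alt (λ c rest → - g c rest) cs ≡ - alt g cs
  alt-neg g cs = trans (alt-cong cs (λ c rest _ → sym (ℤₚ.-1*i≡-i (g c rest))))
                       (trans (alt-*ˡ (- 1ℤ) g cs) (ℤₚ.-1*i≡-i (alt g cs)))

  alt-sub : ∀ g g′ cs → alt (λ c rest → g c rest - g′ c rest) cs ≡ alt g cs - alt g′ cs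
  alt-sub g g′ cs = trans (alt-+ g (λ c rest → - g′ c rest) cs) (cong (alt g cs +_) (alt-neg g′ cs))

  alt-++ : ∀ g C D → alt g (C ++ D) ≡
           alt (λ c rest → g c (rest ++ D)) C + sgn (length C) * alt (λ c rest → g c (C ++ rest)) D
  alt-++ g []      D = sym (trans (ℤₚ.+-identityˡ _) (ℤₚ.*-identityˡ _))
  alt-++ g (x ∷ C) D = begin
    g x (C ++ D) - alt g′ (C ++ D)
      ≡⟨ cong (_-_ (g x (C ++ D))) (alt-++ g′ C D) ⟩
    g x (C ++ D) - (A + sgn (length C) * B)
      ≡⟨ regroup (g x (C ++ D)) A (sgn (length C)) B ⟩
    g x (C ++ D) - A + - sgn (length C) * B
      ≡⟨ cong (λ s → g x (C ++ D) - A + s * B) (sym (sgn-suc (length C))) ⟩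
    g x (C ++ D) - A + sgn (suc (length C)) * B ∎
    where
    open ≡-Reasoning
    g′ = λ c rest → g c (x ∷ rest)
    A = alt (λ c rest → g′ c (rest ++ D)) C
    B = alt (λ c rest → g′ c (C ++ rest)) D
    regroup : ∀ (X A s B : ℤ) → X - (A + s * B) ≡ X - A + - s * B
    regroup = solve-∀

  -- minor M (a ∷ b ∷ R) cs is alt² of M a c * (M b c′ * minor M R rest) over cs;
  -- swapping the rows a and b swaps c and c′.
  alt² : (ℕ → ℕ → List ℕ → ℤ) → List ℕ → ℤ
  alt² G = alt (λ c rest → alt (λ c′ rest′ → G c c′ rest′) rest)

  alt²-antisym : ∀ G cs → alt² G cs + alt² (λ c c′ → G c′ c) cs ≡ 0ℤ
  alt²-antisym G []       = refl
  alt²-antisym G (x ∷ xs) = begin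
    alt² G (x ∷ xs) + alt² G′ (x ∷ xs)
      ≡⟨ cong₂ _+_ (unfold G) (unfold G′) ⟩
    (A - (B - D)) + (B - (A - D′))
      ≡⟨ cancel A B D D′ ⟩
    D + D′
      ≡⟨ alt²-antisym (λ c c′ rest → G c c′ (x ∷ rest)) xs ⟩
    0ℤ ∎
    where
    open ≡-Reasoning
    G′ = λ c c′ → G c′ c
    A = alt (λ c′ rest → G x c′ rest) xs
    B = alt (λ c rest → G c x rest) xs
    D = alt² (λ c c′ rest → G c c′ (x ∷ rest)) xs
    D′ = alt² (λ c c′ rest → G′ c c′ (x ∷ rest)) xs
    unfold : ∀ H → alt² H (x ∷ xs) ≡
             alt (H x) xs - (alt (λ c rest → H c x rest) xs - alt² (λ c c′ rest → H c c′ (x ∷ rest)) xs)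
    unfold H = cong (_-_ (alt (H x) xs))
      (alt-sub (λ c rest → H c x rest) (λ c rest → alt (λ c′ rest′ → H c c′ (x ∷ rest′)) rest) xs)
    cancel : ∀ (A B D D′ : ℤ) → (A - (B - D)) + (B - (A - D′)) ≡ D + D′
    cancel = solve-∀

  minor-swapRows : ∀ M a b R cs → minor M (a ∷ b ∷ R) cs ≡ - minor M (b ∷ a ∷ R) cs
  minor-swapRows M a b R cs = begin
    minor M (a ∷ b ∷ R) cs          ≡⟨ asAlt² a b ⟩
    alt² G cs                       ≡⟨ +-inverseˡ-unique _ _ (alt²-antisym G cs) ⟩
    - alt² (λ c c′ → G c′ c) cs     ≡⟨ cong -_ (trans (alt-cong cs (λ c rest _ → alt-cong rest (λ c′ rest′ _ →
                                         swapFactors (M a c′) (M b c) _))) (sym (asAlt² b a))) ⟩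
    - minor M (b ∷ a ∷ R) cs        ∎
    where
    open ≡-Reasoning
    G = λ c c′ rest → M a c * (M b c′ * minor M R rest)
    asAlt² : ∀ a b → minor M (a ∷ b ∷ R) cs ≡ alt² (λ c c′ rest → M a c * (M b c′ * minor M R rest)) cs
    asAlt² a b = alt-cong cs (λ c rest _ → sym (alt-*ˡ (M a c) (λ c′ rest′ → M b c′ * minor M R rest′) rest))
    swapFactors : ∀ (x y z : ℤ) → x * (y * z) ≡ y * (x * z)
    swapFactors = solve-∀

  minor-prefixRows : ∀ M k X Y → (∀ cs → minor M X cs ≡ k * minor M Y cs) →
                     ∀ P cs → minor M (P ++ X) cs ≡ k * minor M (P ++ Y) cs
  minor-prefixRows M k X Y eq []      cs = eq cs
  minor-prefixRows M k X Y eq (a ∷ P) cs =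
    trans (alt-cong cs (λ c rest _ → trans (cong (M a c *_) (minor-prefixRows M k X Y eq P rest))
                                           (swapFactors (M a c) k (minor M (P ++ Y) rest))))
          (alt-*ˡ k (λ c rest → M a c * minor M (P ++ Y) rest) cs)
    where
    swapFactors : ∀ (x y z : ℤ) → x * (y * z) ≡ y * (x * z)
    swapFactors = solve-∀

  minor-moveRow : ∀ M A x B cs → minor M (A ++ x ∷ B) cs ≡ sgn (length A) * minor M (x ∷ A ++ B) cs
  minor-moveRow M []      x B cs = sym (ℤₚ.*-identityˡ _)
  minor-moveRow M (a ∷ A) x B cs = begin
    minor M (a ∷ A ++ x ∷ B) cs
      ≡⟨ minor-prefixRows M (sgn (length A)) (A ++ x ∷ B) (x ∷ A ++ B) (minor-moveRow M A x B) (a ∷ []) cs ⟩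
    sgn (length A) * minor M (a ∷ x ∷ A ++ B) cs
      ≡⟨ cong (sgn (length A) *_) (minor-swapRows M a x (A ++ B) cs) ⟩
    sgn (length A) * - minor M (x ∷ a ∷ A ++ B) cs
      ≡⟨ sgn-*-neg (length A) _ ⟩
    sgn (suc (length A)) * minor M (x ∷ a ∷ A ++ B) cs ∎
    where open ≡-Reasoning

  minor-swapRowBlocks : ∀ M A B cs →
                        minor M (A ++ B) cs ≡ sgn (length A ℕ.* length B) * minor M (B ++ A) cs
  minor-swapRowBlocks M A [] cs = begin
    minor M (A ++ []) cs                  ≡⟨ cong (λ R → minor M R cs) (++-identityʳ A) ⟩
    minor M A cs                          ≡⟨ sym (ℤₚ.*-identityˡ _) ⟩
    1ℤ * minor M A cs                     ≡⟨ cong (λ n → sgn n * minor M A cs) (sym (ℕₚ.*-zeroʳ (length A))) ⟩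
    sgn (length A ℕ.* 0) * minor M A cs   ∎
    where open ≡-Reasoning
  minor-swapRowBlocks M A (b ∷ B) cs = begin
    minor M (A ++ b ∷ B) cs
      ≡⟨ minor-moveRow M A b B cs ⟩
    sgn (length A) * minor M (b ∷ A ++ B) cs
      ≡⟨ cong (sgn (length A) *_) (minor-prefixRows M (sgn (length A ℕ.* length B)) (A ++ B) (B ++ A)
                                     (minor-swapRowBlocks M A B) (b ∷ []) cs) ⟩
    sgn (length A) * (sgn (length A ℕ.* length B) * minor M (b ∷ B ++ A) cs)
      ≡⟨ sym (ℤₚ.*-assoc (sgn (length A)) _ _) ⟩
    sgn (length A) * sgn (length A ℕ.* length B) * minor M (b ∷ B ++ A) cs
      ≡⟨ cong (_* minor M (b ∷ B ++ A) cs) (sym (sgn-*-suc (length A) (length B))) ⟩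
    sgn (length A ℕ.* suc (length B)) * minor M (b ∷ B ++ A) cs ∎
    where open ≡-Reasoning

  length-swapped : ∀ P (a b : ℕ) Q → length (P ++ a ∷ b ∷ Q) ≡ suc (suc (length P ℕ.+ length Q))
  length-swapped []      a b Q = refl
  length-swapped (x ∷ P) a b Q = cong suc (length-swapped P a b Q)

  -- An alternating sum is antisymmetric in two adjacent entries if all its
  -- terms are; k tracks the length so that the hypothesis may be restricted.
  alt-swapAdjacent : ∀ a b k g →
    (∀ c P Q → suc (length P ℕ.+ length Q) ≡ k → g c (P ++ a ∷ b ∷ Q) ≡ - g c (P ++ b ∷ a ∷ Q)) →
    ∀ P Q → length P ℕ.+ length Q ≡ k → alt g (P ++ a ∷ b ∷ Q) ≡ - alt g (P ++ b ∷ a ∷ Q)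
  alt-swapAdjacent a b k g anti [] Q eq =
    swapHead (g a (b ∷ Q)) (g b (a ∷ Q))
      (trans (alt-cong Q (λ c rest d → anti c [] rest (trans (sym (Drop-length d)) eq)))
             (alt-neg (λ c rest → g c (b ∷ a ∷ rest)) Q))
    where
    swapHead : ∀ (p q : ℤ) {X Y : ℤ} → X ≡ - Y → p - (q - X) ≡ - (q - (p - Y))
    swapHead p q {Y = Y} refl = lemma p q Y
      where
      lemma : ∀ (p q Y : ℤ) → p - (q - - Y) ≡ - (q - (p - Y))
      lemma = solve-∀
  alt-swapAdjacent a b k g anti (p ∷ P) Q eq =
    trans (cong₂ _-_ (anti p P Q eq)
            (alt-swapAdjacent a b (length P ℕ.+ length Q) (λ c rest → g c (p ∷ rest))
              (λ c P′ Q′ eq′ → anti c (p ∷ P′) Q′ (trans (cong suc eq′) eq)) P Q refl))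
          (sym (ℤₚ.neg-distrib-+ (g p (P ++ b ∷ a ∷ Q)) (- alt (λ c rest → g c (p ∷ rest)) (P ++ b ∷ a ∷ Q))))

  minor-swapCols : ∀ M R P a b Q → length R ≡ length (P ++ a ∷ b ∷ Q) →
                   minor M R (P ++ a ∷ b ∷ Q) ≡ - minor M R (P ++ b ∷ a ∷ Q)
  minor-swapCols M [] P a b Q eq with () ← trans eq (length-swapped P a b Q)
  minor-swapCols M (r ∷ R) P a b Q eq =
    alt-swapAdjacent a b (length P ℕ.+ length Q) (λ c rest → M r c * minor M R rest)
      (λ c P′ Q′ eq′ → trans (cong (M r c *_) (minor-swapCols M R P′ a b Q′ (lengths P′ Q′ eq′)))
                             (sym (ℤₚ.neg-distribʳ-* (M r c) _)))
      P Q refl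
    where
    lengths : ∀ P′ Q′ → suc (length P′ ℕ.+ length Q′) ≡ length P ℕ.+ length Q →
              length R ≡ length (P′ ++ a ∷ b ∷ Q′)
    lengths P′ Q′ eq′ = ℕₚ.suc-injective (trans eq (trans (length-swapped P a b Q)
                          (trans (cong (λ n → suc (suc n)) (sym eq′)) (cong suc (sym (length-swapped P′ a b Q′))))))

  minor-moveCol : ∀ M R P A x B → length R ≡ length (P ++ A ++ x ∷ B) →
                  minor M R (P ++ A ++ x ∷ B) ≡ sgn (length A) * minor M R (P ++ x ∷ A ++ B)
  minor-moveCol M R P []      x B eq = sym (ℤₚ.*-identityˡ _)
  minor-moveCol M R P (a ∷ A) x B eq = begin
    minor M R (P ++ a ∷ A ++ x ∷ B)
      ≡⟨ cong (minor M R) (reassoc (A ++ x ∷ B)) ⟩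
    minor M R (P′ ++ A ++ x ∷ B)
      ≡⟨ minor-moveCol M R P′ A x B (trans eq (cong length (reassoc (A ++ x ∷ B)))) ⟩
    sgn (length A) * minor M R (P′ ++ x ∷ A ++ B)
      ≡⟨ cong (λ cs → sgn (length A) * minor M R cs) (sym (reassoc (x ∷ A ++ B))) ⟩
    sgn (length A) * minor M R (P ++ a ∷ x ∷ A ++ B)
      ≡⟨ cong (sgn (length A) *_) (minor-swapCols M R P a x (A ++ B)
           (trans eq (↭-length (++⁺ˡ P (prep a (shift x A B)))))) ⟩
    sgn (length A) * - minor M R (P ++ x ∷ a ∷ A ++ B)
      ≡⟨ sgn-*-neg (length A) _ ⟩
    sgn (suc (length A)) * minor M R (P ++ x ∷ a ∷ A ++ B) ∎
    where
    open ≡-Reasoning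
    P′ = P ++ a ∷ []
    reassoc : ∀ cs → P ++ a ∷ cs ≡ P′ ++ cs
    reassoc cs = sym (++-assoc P (a ∷ []) cs)

  minor-swapColBlocks : ∀ M R P A B → length R ≡ length (P ++ A ++ B) →
    minor M R (P ++ A ++ B) ≡ sgn (length A ℕ.* length B) * minor M R (P ++ B ++ A)
  minor-swapColBlocks M R P A [] eq = begin
    minor M R (P ++ A ++ [])                   ≡⟨ cong (λ cs → minor M R (P ++ cs)) (++-identityʳ A) ⟩
    minor M R (P ++ A)                         ≡⟨ sym (ℤₚ.*-identityˡ _) ⟩
    1ℤ * minor M R (P ++ A)                    ≡⟨ cong (λ n → sgn n * minor M R (P ++ A)) (sym (ℕₚ.*-zeroʳ (length A))) ⟩
    sgn (length A ℕ.* 0) * minor M R (P ++ A)  ∎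
    where open ≡-Reasoning
  minor-swapColBlocks M R P A (b ∷ B) eq = begin
    minor M R (P ++ A ++ b ∷ B)
      ≡⟨ minor-moveCol M R P A b B eq ⟩
    sgn (length A) * minor M R (P ++ b ∷ A ++ B)
      ≡⟨ cong (λ cs → sgn (length A) * minor M R cs) (reassoc (A ++ B)) ⟩
    sgn (length A) * minor M R (P′ ++ A ++ B)
      ≡⟨ cong (sgn (length A) *_) (minor-swapColBlocks M R P′ A B
           (trans eq (trans (↭-length (++⁺ˡ P (shift b A B))) (cong length (reassoc (A ++ B)))))) ⟩
    sgn (length A) * (sgn (length A ℕ.* length B) * minor M R (P′ ++ B ++ A))
      ≡⟨ sym (ℤₚ.*-assoc (sgn (length A)) _ _) ⟩
    sgn (length A) * sgn (length A ℕ.* length B) * minor M R (P′ ++ B ++ A)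
      ≡⟨ cong₂ _*_ (sym (sgn-*-suc (length A) (length B))) (cong (minor M R) (sym (reassoc (B ++ A)))) ⟩
    sgn (length A ℕ.* suc (length B)) * minor M R (P ++ b ∷ B ++ A) ∎
    where
    open ≡-Reasoning
    P′ = P ++ b ∷ []
    reassoc : ∀ cs → P ++ b ∷ cs ≡ P′ ++ cs
    reassoc cs = sym (++-assoc P (b ∷ []) cs)

  -- Block structure

  minor-cong : ∀ M M′ rs cs → (∀ r c → r ∈ rs → c ∈ cs → M r c ≡ M′ r c) → minor M rs cs ≡ minor M′ rs cs
  minor-cong M M′ []       cs eq = refl
  minor-cong M M′ (r ∷ rs) cs eq = alt-cong cs (λ c rest d →
    cong₂ _*_ (eq r c (here refl) (Drop⇒∈ d))
              (minor-cong M M′ rs rest (λ r′ c′ i j → eq r′ c′ (there i) (Drop-⊆ d j))))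

  alt-map : ∀ (ψ : ℕ → ℕ) g cs → alt g (map ψ cs) ≡ alt (λ c rest → g (ψ c) (map ψ rest)) cs
  alt-map ψ g []       = refl
  alt-map ψ g (x ∷ xs) = cong (_-_ (g (ψ x) (map ψ xs))) (alt-map ψ (λ c rest → g c (ψ x ∷ rest)) xs)

  minor-map : ∀ M (φ ψ : ℕ → ℕ) rs cs → minor M (map φ rs) (map ψ cs) ≡ minor (λ r c → M (φ r) (ψ c)) rs cs
  minor-map M φ ψ []       cs = refl
  minor-map M φ ψ (r ∷ rs) cs = trans (alt-map ψ _ cs)
    (alt-cong cs (λ c rest _ → cong (M (φ r) (ψ c) *_) (minor-map M φ ψ rs rest)))

  minor-fewerCols : ∀ M rs cs → length cs < length rs → minor M rs cs ≡ 0ℤ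
  minor-fewerCols M (r ∷ rs) cs (s≤s lt) = alt-zero cs (λ c rest d →
    trans (cong (M r c *_) (minor-fewerCols M rs rest (ℕₚ.≤-trans (ℕₚ.≤-reflexive (sym (Drop-length d))) lt)))
          (ℤₚ.*-zeroʳ (M r c)))

  ZeroBlock : Matrix → List ℕ → List ℕ → Set
  ZeroBlock M R C = ∀ r c → r ∈ R → c ∈ C → M r c ≡ 0ℤ

  minor-blockTriangular : ∀ M R₁ R₂ C₁ C₂ → ZeroBlock M R₁ C₂ → length C₁ ≤ length R₁ →
                          minor M (R₁ ++ R₂) (C₁ ++ C₂) ≡ minor M R₁ C₁ * minor M R₂ C₂
  minor-blockTriangular M []       R₂ []  C₂ offBlock le = sym (ℤₚ.*-identityˡ _)
  minor-blockTriangular M (r ∷ R₁) R₂ C₁ C₂ offBlock le = begin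
    alt (λ c rest → M r c * minor M (R₁ ++ R₂) rest) (C₁ ++ C₂)
      ≡⟨ alt-++ (λ c rest → M r c * minor M (R₁ ++ R₂) rest) C₁ C₂ ⟩
    alt (λ c rest → M r c * minor M (R₁ ++ R₂) (rest ++ C₂)) C₁
      + sgn (length C₁) * alt (λ c rest → M r c * minor M (R₁ ++ R₂) (C₁ ++ rest)) C₂
      ≡⟨ cong₂ (λ x y → x + sgn (length C₁) * y) leftBlock rightBlock ⟩
    minor M (r ∷ R₁) C₁ * minor M R₂ C₂ + sgn (length C₁) * 0ℤ
      ≡⟨ trans (cong (minor M (r ∷ R₁) C₁ * minor M R₂ C₂ +_) (ℤₚ.*-zeroʳ (sgn (length C₁))))
               (ℤₚ.+-identityʳ _) ⟩
    minor M (r ∷ R₁) C₁ * minor M R₂ C₂ ∎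
    where
    open ≡-Reasoning
    leftBlock : alt (λ c rest → M r c * minor M (R₁ ++ R₂) (rest ++ C₂)) C₁ ≡ minor M (r ∷ R₁) C₁ * minor M R₂ C₂
    leftBlock = trans (alt-cong C₁ (λ c rest d → trans
                  (cong (M r c *_) (minor-blockTriangular M R₁ R₂ rest C₂ (λ r′ c′ i j → offBlock r′ c′ (there i) j)
                     (ℕₚ.≤-pred (ℕₚ.≤-trans (ℕₚ.≤-reflexive (sym (Drop-length d))) le))))
                  (sym (ℤₚ.*-assoc (M r c) (minor M R₁ rest) (minor M R₂ C₂)))))
                (alt-*ʳ (minor M R₂ C₂) (λ c rest → M r c * minor M R₁ rest) C₁)
    rightBlock : alt (λ c rest → M r c * minor M (R₁ ++ R₂) (C₁ ++ rest)) C₂ ≡ 0ℤ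
    rightBlock = alt-zero C₂ (λ c rest d → cong (_* minor M (R₁ ++ R₂) (C₁ ++ rest)) (offBlock r c (here refl) (Drop⇒∈ d)))

  minor-offDiagonal : ∀ M R C → ZeroBlock M R R → length C ≤ length R →
                      minor M (R ++ C) (R ++ C) ≡ sgn (length R ℕ.* length C) * (minor M R C * minor M C R)
  minor-offDiagonal M R C offBlock le =
    trans (minor-swapColBlocks M (R ++ C) [] R C refl)
          (cong (sgn (length R ℕ.* length C) *_) (minor-blockTriangular M R C C R offBlock le))

  minor-deficient : ∀ M R₁ R₂ C₁ C₂ → ZeroBlock M R₁ C₂ → length C₁ < length R₁ →
                    minor M (R₁ ++ R₂) (C₁ ++ C₂) ≡ 0ℤ
  minor-deficient M R₁ R₂ C₁ C₂ offBlock lt =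
    trans (minor-blockTriangular M R₁ R₂ C₁ C₂ offBlock (ℕₚ.<⇒≤ lt))
          (cong (_* minor M R₂ C₂) (minor-fewerCols M R₁ C₁ lt))

  minor-offDiagonal-<ˡ : ∀ M R C → ZeroBlock M R R → length C < length R → minor M (R ++ C) (R ++ C) ≡ 0ℤ
  minor-offDiagonal-<ˡ M R C offBlock lt =
    trans (minor-swapColBlocks M (R ++ C) [] R C refl)
          (trans (cong (sgn (length R ℕ.* length C) *_) (minor-deficient M R C C R offBlock lt))
                 (ℤₚ.*-zeroʳ (sgn (length R ℕ.* length C))))

  minor-offDiagonal-<ʳ : ∀ M R C → ZeroBlock M C C → length R < length C → minor M (R ++ C) (R ++ C) ≡ 0ℤ
  minor-offDiagonal-<ʳ M R C offBlock lt =
    trans (minor-swapRowBlocks M R C (R ++ C))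
          (trans (cong (sgn (length R ℕ.* length C) *_) (minor-deficient M C R R C offBlock lt))
                 (ℤₚ.*-zeroʳ (sgn (length R ℕ.* length C))))

  withRow : Matrix → ℕ → (ℕ → ℤ) → Matrix
  withRow M r u r′ c = if r′ ≡ᵇ r then u c else M r′ c

  withRow-≢ : ∀ M r u {r′} c → r′ ≢ r → withRow M r u r′ c ≡ M r′ c
  withRow-≢ M r u {r′} c ne with r′ ≡ᵇ r in eq
  ... | true  = ⊥-elim (ne (ℕₚ.≡ᵇ⇒≡ r′ r (subst T (sym eq) tt)))
  ... | false = refl

  minor-withRow : ∀ M r u rs cs → (∀ {r′} → r′ ∈ rs → r′ ≢ r) → minor (withRow M r u) rs cs ≡ minor M rs cs
  minor-withRow M r u rs cs other = minor-cong (withRow M r u) M rs cs (λ r′ c i _ → withRow-≢ M r u c (other i))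

  minor-splitRow : ∀ M r u v rs cs → (∀ c → M r c ≡ u c + v c) → (∀ {r′} → r′ ∈ rs → r′ ≢ r) →
    minor M (r ∷ rs) cs ≡ minor (withRow M r u) (r ∷ rs) cs + minor (withRow M r v) (r ∷ rs) cs
  minor-splitRow M r u v rs cs split other = trans
    (alt-cong cs (λ c rest _ → trans (cong (_* minor M rs rest) (split c))
      (trans (ℤₚ.*-distribʳ-+ (minor M rs rest) (u c) (v c))
        (cong₂ _+_ (cong₂ _*_ (sym (withRow-≡ u c)) (sym (minor-withRow M r u rs rest other)))
                   (cong₂ _*_ (sym (withRow-≡ v c)) (sym (minor-withRow M r v rs rest other)))))))
    (alt-+ (λ c rest → withRow M r u r c * minor (withRow M r u) rs rest)
           (λ c rest → withRow M r v r c * minor (withRow M r v) rs rest) cs)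
    where
    withRow-≡ : ∀ w c → withRow M r w r c ≡ w c
    withRow-≡ w c with r ≡ᵇ r in eq
    ... | true  = refl
    ... | false = ⊥-elim (subst T eq (ℕₚ.≡⇒≡ᵇ r r refl))

  minor-expandSparseRow : ∀ M r R A c₀ B → (∀ {c} → c ∈ A → M r c ≡ 0ℤ) → (∀ {c} → c ∈ B → M r c ≡ 0ℤ) →
                          minor M (r ∷ R) (A ++ c₀ ∷ B) ≡ sgn (length A) * (M r c₀ * minor M R (A ++ B))
  minor-expandSparseRow M r R A c₀ B zeroA zeroB = begin
    alt g (A ++ c₀ ∷ B)
      ≡⟨ alt-++ g A (c₀ ∷ B) ⟩
    alt (λ c rest → g c (rest ++ c₀ ∷ B)) A + sgn (length A) * (g c₀ (A ++ B) - alt (λ c rest → g c (A ++ c₀ ∷ rest)) B)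
      ≡⟨ cong₂ (λ x y → x + sgn (length A) * (g c₀ (A ++ B) - y))
           (alt-zero A (λ c rest d → cong (_* minor M R (rest ++ c₀ ∷ B)) (zeroA (Drop⇒∈ d))))
           (alt-zero B (λ c rest d → cong (_* minor M R (A ++ c₀ ∷ rest)) (zeroB (Drop⇒∈ d)))) ⟩
    0ℤ + sgn (length A) * (g c₀ (A ++ B) - 0ℤ)
      ≡⟨ simplify (sgn (length A)) (g c₀ (A ++ B)) ⟩
    sgn (length A) * (M r c₀ * minor M R (A ++ B)) ∎
    where
    open ≡-Reasoning
    g = λ c rest → M r c * minor M R rest
    simplify : ∀ (s x : ℤ) → 0ℤ + s * (x - 0ℤ) ≡ s * x
    simplify = solve-∀

  -- Reordering rows and columns by a predicate

  partitioned : (ℕ → Bool) → List ℕ → List ℕ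
  partitioned p xs = filterᵇ p xs ++ filterᵇ (λ x → not (p x)) xs

  inversions : (ℕ → Bool) → List ℕ → ℕ
  inversions p []       = 0
  inversions p (x ∷ xs) = if p x then inversions p xs else length (filterᵇ p xs) ℕ.+ inversions p xs

  partitioned-↭ : ∀ p xs → partitioned p xs ↭ xs
  partitioned-↭ p []       = ↭-refl
  partitioned-↭ p (x ∷ xs) with p x
  ... | true  = prep x (partitioned-↭ p xs)
  ... | false = ↭-trans (shift x (filterᵇ p xs) _) (prep x (partitioned-↭ p xs))

  minor-partitionRows : ∀ M p xs cs → minor M (partitioned p xs) cs ≡ sgn (inversions p xs) * minor M xs cs
  minor-partitionRows M p []       cs = refl
  minor-partitionRows M p (x ∷ xs) cs with p x
  ... | true  = minor-prefixRows M (sgn (inversions p xs)) (partitioned p xs) xs (minor-partitionRows M p xs) (x ∷ []) cs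
  ... | false = begin
    minor M (filterᵇ p xs ++ x ∷ filterᵇ (λ y → not (p y)) xs) cs
      ≡⟨ minor-moveRow M (filterᵇ p xs) x _ cs ⟩
    sgn k * minor M (x ∷ partitioned p xs) cs
      ≡⟨ cong (sgn k *_) (minor-prefixRows M (sgn (inversions p xs)) (partitioned p xs) xs
                            (minor-partitionRows M p xs) (x ∷ []) cs) ⟩
    sgn k * (sgn (inversions p xs) * minor M (x ∷ xs) cs)
      ≡⟨ sym (ℤₚ.*-assoc (sgn k) _ _) ⟩
    sgn k * sgn (inversions p xs) * minor M (x ∷ xs) cs
      ≡⟨ cong (_* minor M (x ∷ xs) cs) (sym (sgn-+ k (inversions p xs))) ⟩
    sgn (k ℕ.+ inversions p xs) * minor M (x ∷ xs) cs ∎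
    where
    open ≡-Reasoning
    k = length (filterᵇ p xs)

  minor-partitionCols : ∀ M R p P xs → length R ≡ length (P ++ xs) →
                        minor M R (P ++ partitioned p xs) ≡ sgn (inversions p xs) * minor M R (P ++ xs)
  minor-partitionCols M R p P []       eq = sym (ℤₚ.*-identityˡ _)
  minor-partitionCols M R p P (x ∷ xs) eq with p x
  ... | true  = begin
    minor M R (P ++ x ∷ partitioned p xs)
      ≡⟨ cong (minor M R) (reassoc (partitioned p xs)) ⟩
    minor M R (P′ ++ partitioned p xs)
      ≡⟨ minor-partitionCols M R p P′ xs (trans eq (cong length (reassoc xs))) ⟩
    sgn (inversions p xs) * minor M R (P′ ++ xs)
      ≡⟨ cong (λ cs → sgn (inversions p xs) * minor M R cs) (sym (reassoc xs)) ⟩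
    sgn (inversions p xs) * minor M R (P ++ x ∷ xs) ∎
    where
    open ≡-Reasoning
    P′ = P ++ x ∷ []
    reassoc : ∀ cs → P ++ x ∷ cs ≡ P′ ++ cs
    reassoc cs = sym (++-assoc P (x ∷ []) cs)
  ... | false = begin
    minor M R (P ++ filterᵇ p xs ++ x ∷ filterᵇ (λ y → not (p y)) xs)
      ≡⟨ minor-moveCol M R P (filterᵇ p xs) x _ (trans eq (↭-length (++⁺ˡ P (↭-sym
           (↭-trans (shift x (filterᵇ p xs) _) (prep x (partitioned-↭ p xs))))))) ⟩
    sgn k * minor M R (P ++ x ∷ partitioned p xs)
      ≡⟨ cong (λ cs → sgn k * minor M R cs) (reassoc (partitioned p xs)) ⟩
    sgn k * minor M R (P′ ++ partitioned p xs)
      ≡⟨ cong (sgn k *_) (minor-partitionCols M R p P′ xs (trans eq (cong length (reassoc xs)))) ⟩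
    sgn k * (sgn (inversions p xs) * minor M R (P′ ++ xs))
      ≡⟨ sym (ℤₚ.*-assoc (sgn k) _ _) ⟩
    sgn k * sgn (inversions p xs) * minor M R (P′ ++ xs)
      ≡⟨ cong₂ _*_ (sym (sgn-+ k (inversions p xs))) (cong (minor M R) (sym (reassoc xs))) ⟩
    sgn (k ℕ.+ inversions p xs) * minor M R (P ++ x ∷ xs) ∎
    where
    open ≡-Reasoning
    k = length (filterᵇ p xs)
    P′ = P ++ x ∷ []
    reassoc : ∀ cs → P ++ x ∷ cs ≡ P′ ++ cs
    reassoc cs = sym (++-assoc P (x ∷ []) cs)

  minor-partition : ∀ M p xs → minor M (partitioned p xs) (partitioned p xs) ≡ minor M xs xs
  minor-partition M p xs = begin
    minor M (partitioned p xs) (partitioned p xs)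
      ≡⟨ minor-partitionCols M (partitioned p xs) p [] xs (↭-length (partitioned-↭ p xs)) ⟩
    sgn (inversions p xs) * minor M (partitioned p xs) xs
      ≡⟨ cong (sgn (inversions p xs) *_) (minor-partitionRows M p xs xs) ⟩
    sgn (inversions p xs) * (sgn (inversions p xs) * minor M xs xs)
      ≡⟨ sym (ℤₚ.*-assoc (sgn (inversions p xs)) _ _) ⟩
    sgn (inversions p xs) * sgn (inversions p xs) * minor M xs xs
      ≡⟨ trans (cong (_* minor M xs xs) (sgn-square (inversions p xs))) (ℤₚ.*-identityˡ _) ⟩
    minor M xs xs ∎
    where open ≡-Reasoning

  ∑-cong : ∀ {n} {F G : Fin n → ℤ} → (∀ j → F j ≡ G j) → ∑ F ≡ ∑ G
  ∑-cong {zero}  eq = refl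
  ∑-cong {suc n} eq = cong₂ _+_ (eq zero) (∑-cong (λ j → eq (suc j)))

  ∑-neg : ∀ {n} (F : Fin n → ℤ) → ∑ (λ j → - F j) ≡ - ∑ F
  ∑-neg {zero}  F = refl
  ∑-neg {suc n} F = trans (cong (- F zero +_) (∑-neg (λ j → F (suc j))))
                          (sym (ℤₚ.neg-distrib-+ (F zero) (∑ (λ j → F (suc j)))))

  alt-tabulate : ∀ n (κ : Fin (suc n) → ℕ) g →
                 alt g (tabulate κ) ≡ ∑ (λ j → sgn (toℕ j) * g (κ j) (tabulate (λ c → κ (punchIn j c))))
  alt-tabulate zero    κ g = simplify (g (κ zero) [])
    where
    simplify : ∀ (x : ℤ) → x - 0ℤ ≡ 1ℤ * x + 0ℤ
    simplify = solve-∀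
  alt-tabulate (suc n) κ g = begin
    g (κ zero) rest - alt g′ rest
      ≡⟨ cong₂ _-_ (sym (ℤₚ.*-identityˡ (g (κ zero) rest))) (alt-tabulate n (λ i → κ (suc i)) g′) ⟩
    1ℤ * g (κ zero) rest - ∑ F
      ≡⟨ cong (1ℤ * g (κ zero) rest +_) (sym (trans (∑-cong flipSign) (∑-neg F))) ⟩
    1ℤ * g (κ zero) rest
      + ∑ (λ j → sgn (suc (toℕ j)) * g (κ (suc j)) (κ zero ∷ tabulate (λ c → κ (suc (punchIn j c))))) ∎
    where
    open ≡-Reasoning
    rest = tabulate (λ i → κ (suc i))
    g′ = λ c rest → g c (κ zero ∷ rest)
    F = λ j → sgn (toℕ j) * g′ (κ (suc j)) (tabulate (λ c → κ (suc (punchIn j c))))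
    flipSign : ∀ j → sgn (suc (toℕ j)) * g′ (κ (suc j)) (tabulate (λ c → κ (suc (punchIn j c)))) ≡ - F j
    flipSign j = trans (cong (_* g′ (κ (suc j)) rest′) (sgn-suc (toℕ j))) (sym (ℤₚ.neg-distribˡ-* (sgn (toℕ j)) _))
      where rest′ = tabulate (λ c → κ (suc (punchIn j c)))

  det≡minor : ∀ n M (ρ κ : Fin n → ℕ) → det n (λ i j → M (ρ i) (κ j)) ≡ minor M (tabulate ρ) (tabulate κ)
  det≡minor zero    M ρ κ = refl
  det≡minor (suc n) M ρ κ = trans
    (∑-cong (λ j → cong (λ d → sgn (toℕ j) * (M (ρ zero) (κ j) * d))
                        (det≡minor n M (λ i → ρ (suc i)) (λ c → κ (punchIn j c)))))
    (sym (alt-tabulate n κ (λ c rest → M (ρ zero) c * minor M (tabulate (λ i → ρ (suc i))) rest)))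

module HankelDeterminants where

  open import Data.Nat as ℕ using (ℕ; zero; suc; _≤_; _<_; s≤s; z≤n; _^_; _≡ᵇ_)
  import Data.Nat.Properties as ℕₚ
  open import Data.Integer as ℤ using (ℤ; -_; _+_; _*_; _-_; 0ℤ; 1ℤ)
  import Data.Integer.Properties as ℤₚ
  open import Data.Integer.Tactic.RingSolver using (solve-∀)
  open import Data.Bool using (Bool; true; false; if_then_else_; not; T)
  import Data.Bool.Properties as Boolₚ
  open import Data.Product using (∃-syntax; _×_; _,_; proj₁; proj₂)
  open import Data.List using (List; []; _∷_; _++_; length; applyUpTo; upTo; tabulate; filterᵇ; map)
  open import Data.List.Properties using (map-upTo; length-applyUpTo)
  open import Data.List.Relation.Binary.Permutation.Propositional.Properties using (↭-length; ++-comm)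
  open import Data.List.Membership.Propositional using (_∈_)
  open import Data.List.Membership.Propositional.Properties using (∈-applyUpTo⁻; ∈-++⁻)
  open import Data.Sum using (_⊎_; inj₁; inj₂)
  open import Data.Nat.Induction using (<-rec)
  open import Data.Fin using (toℕ)
  open import Data.Empty using (⊥-elim)
  open import Data.Unit using (tt)
  open import Function.Base using (id)
  open import Function.Bundles using (_⇔_; mk⇔; Equivalence)
  open import Function.Construct.Composition using (_⇔-∘_)
  open import Function.Construct.Symmetry using (⇔-sym)
  open import Relation.Nullary using (¬_; yes; no)
  open import Relation.Binary.PropositionalEquality
  open import Defs
  open Minors

  double : ℕ → ℕ
  double zero    = zero
  double (suc n) = suc (suc (double n))

  odd : ℕ → ℕ
  odd n = suc (double n)

  2*≡double : ∀ n → 2 ℕ.* n ≡ double n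
  2*≡double zero    = refl
  2*≡double (suc n) = cong suc (trans (ℕₚ.+-suc n (n ℕ.+ 0)) (cong suc (2*≡double n)))

  double-injective : ∀ {m n} → double m ≡ double n → m ≡ n
  double-injective {zero}  {zero}  eq = refl
  double-injective {suc m} {suc n} eq = cong suc (double-injective (ℕₚ.suc-injective (ℕₚ.suc-injective eq)))

  double≢odd : ∀ m n → double m ≢ odd n
  double≢odd (suc (suc m)) zero    ()
  double≢odd (suc m)       (suc n) eq = double≢odd m n (ℕₚ.suc-injective (ℕₚ.suc-injective eq))

  double-+ : ∀ m n → double m ℕ.+ double n ≡ double (m ℕ.+ n)
  double-+ zero    n = refl
  double-+ (suc m) n = cong (λ k → suc (suc k)) (double-+ m n)

  double-+-suc : ∀ m n → double m ℕ.+ suc (double n) ≡ suc (double (m ℕ.+ n))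
  double-+-suc m n = trans (ℕₚ.+-suc (double m) (double n)) (cong suc (double-+ m n))

  data Half : ℕ → Set where
    twice   : ∀ m → Half (double m)
    twice+1 : ∀ m → Half (suc (double m))

  half : ∀ n → Half n
  half zero = twice 0
  half (suc n) with half n
  ... | twice m   = twice+1 m
  ... | twice+1 m = twice (suc m)

  m≤double : ∀ m → m ≤ double m
  m≤double zero    = z≤n
  m≤double (suc m) = s≤s (ℕₚ.m≤n⇒m≤1+n (m≤double m))

  sgn-double : ∀ n → sgn (double n) ≡ 1ℤ
  sgn-double zero    = refl
  sgn-double (suc n) = sgn-double n

  sgn-odd : ∀ n → sgn (odd n) ≡ - 1ℤ
  sgn-odd n = trans (sgn-suc (double n)) (cong -_ (sgn-double n))

  sgn-*-self : ∀ m → sgn (m ℕ.* m) ≡ sgn m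
  sgn-*-self zero    = refl
  sgn-*-self (suc m) = begin
    sgn (suc (m ℕ.+ m ℕ.* suc m))           ≡⟨ sgn-suc (m ℕ.+ m ℕ.* suc m) ⟩
    - sgn (m ℕ.+ m ℕ.* suc m)               ≡⟨ cong -_ (sgn-+ m (m ℕ.* suc m)) ⟩
    - (sgn m * sgn (m ℕ.* suc m))           ≡⟨ cong (λ x → - (sgn m * x)) (sgn-*-suc m m) ⟩
    - (sgn m * (sgn m * sgn (m ℕ.* m)))     ≡⟨ cong -_ (sym (ℤₚ.*-assoc (sgn m) (sgn m) _)) ⟩
    - (sgn m * sgn m * sgn (m ℕ.* m))       ≡⟨ cong (λ x → - (x * sgn (m ℕ.* m))) (sgn-square m) ⟩
    - (1ℤ * sgn (m ℕ.* m))                  ≡⟨ cong -_ (trans (ℤₚ.*-identityˡ _) (sgn-*-self m)) ⟩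
    - sgn m                                 ≡⟨ sym (sgn-suc m) ⟩
    sgn (suc m)                             ∎
    where open ≡-Reasoning

  PowerOf2 : ℕ → Set
  PowerOf2 k = ∃[ i ] 2 ^ i ≡ k

  n<2^n : ∀ n → n < 2 ^ n
  n<2^n zero    = s≤s z≤n
  n<2^n (suc n) = subst (suc (suc n) ≤_) (cong (2 ^ n ℕ.+_) (sym (ℕₚ.+-identityʳ (2 ^ n))))
                        (ℕₚ.+-mono-≤ (ℕₚ.m^n>0 2 n) (n<2^n n))

  PowerOf2-double : ∀ n → PowerOf2 (double (suc n)) ⇔ PowerOf2 (suc n)
  PowerOf2-double n = mk⇔ halve (λ (i , eq) → suc i , trans (2*≡double (2 ^ i)) (cong double eq))
    where
    halve : PowerOf2 (double (suc n)) → PowerOf2 (suc n)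
    halve (suc i , eq) = i , double-injective (trans (sym (2*≡double (2 ^ i))) eq)

  ¬PowerOf2-odd : ∀ n → ¬ PowerOf2 (odd (suc n))
  ¬PowerOf2-odd n (suc i , eq) = double≢odd (2 ^ i) (suc n) (trans (sym (2*≡double (2 ^ i))) eq)

  -- localSearch is the search function local to isPow2: unification solves the
  -- hole from the with-abstracted equation below, whose right-hand side
  -- applies it to two variables.
  mutual
    localSearch : ℕ → ℕ → Bool
    localSearch = _

    isPow2-unfold : ∀ k → isPow2 (suc k) ≡
                    (if 2 ^ suc k ≡ᵇ suc k then true else (if 2 ^ k ≡ᵇ suc k then true else localSearch (suc k) k))
    isPow2-unfold k with suc k
    ... | n = refl

  Searched : ℕ → ℕ → Bool → Set
  Searched k m b = b ≡ true ⇔ (∃[ i ] i < m × 2 ^ i ≡ k)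

  Searched-suc : ∀ {k m b} → Searched k m b → Searched k (suc m) (if 2 ^ m ≡ᵇ k then true else b)
  Searched-suc {k} {m} {b} inv with 2 ^ m ≡ᵇ k in eq
  ... | true  = mk⇔ (λ _ → m , ℕₚ.n<1+n m , ℕₚ.≡ᵇ⇒≡ (2 ^ m) k (subst T (sym eq) tt)) (λ _ → refl)
  ... | false = mk⇔ (λ b≡true → let (i , i<m , 2^i≡k) = Equivalence.to inv b≡true in i , ℕₚ.m<n⇒m<1+n i<m , 2^i≡k)
                    earlier
    where
    earlier : (∃[ i ] i < suc m × 2 ^ i ≡ k) → b ≡ true
    earlier (i , i<1+m , 2^i≡k) with i ℕ.≟ m
    ... | yes refl = ⊥-elim (subst T eq (ℕₚ.≡⇒≡ᵇ (2 ^ m) k 2^i≡k))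
    ... | no i≢m  = Equivalence.from inv (i , ℕₚ.≤∧≢⇒< (ℕₚ.≤-pred i<1+m) i≢m , 2^i≡k)

  localSearch-correct : ∀ k m → Searched k m (localSearch k m)
  localSearch-correct k zero    = mk⇔ (λ ()) (λ ())
  localSearch-correct k (suc m) = Searched-suc (localSearch-correct k m)

  Searched⇒PowerOf2 : ∀ {k m b} → k < m → Searched k m b → b ≡ true ⇔ PowerOf2 k
  Searched⇒PowerOf2 {k} k<m inv = mk⇔ (λ b≡true → let (i , _ , 2^i≡k) = Equivalence.to inv b≡true in i , 2^i≡k)
    (λ (i , 2^i≡k) → Equivalence.from inv (i , ℕₚ.<-trans (subst (i <_) 2^i≡k (n<2^n i)) k<m , 2^i≡k))

  isPow2-correct : ∀ k → isPow2 (suc k) ≡ true ⇔ PowerOf2 (suc k)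
  isPow2-correct k = subst (λ b → b ≡ true ⇔ PowerOf2 (suc k)) (sym (isPow2-unfold k))
    (Searched⇒PowerOf2 (ℕₚ.n<1+n (suc k)) (localSearch-correct (suc k) (suc (suc k))))

  f-double : ∀ n → f (double n) ≡ f n
  f-double zero    = refl
  f-double (suc n) = cong (λ b → - (if b then 1ℤ else 0ℤ)) (Boolₚ.⇔→≡
    (⇔-sym (isPow2-correct n) ⇔-∘ (PowerOf2-double n ⇔-∘ isPow2-correct (suc (double n)))))

  f-odd : ∀ n → f (odd (suc n)) ≡ 0ℤ
  f-odd n with isPow2 (odd (suc n)) in eq
  ... | true  = ⊥-elim (¬PowerOf2-odd n (Equivalence.to (isPow2-correct (double (suc n))) eq))
  ... | false = refl

  -- Splitting indices by parity

  shifted : ℕ → Matrix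
  shifted s i j = f (s ℕ.+ (i ℕ.+ j))

  Hankel : ℕ → ℕ → ℤ
  Hankel s n = minor (shifted s) (upTo n) (upTo n)

  tabulate-toℕ : ∀ n (g : ℕ → ℕ) → tabulate {n = n} (λ i → g (toℕ i)) ≡ applyUpTo g n
  tabulate-toℕ zero    g = refl
  tabulate-toℕ (suc n) g = cong (g 0 ∷_) (tabulate-toℕ n (λ i → g (suc i)))

  h≡Hankel : ∀ n → h n ≡ Hankel 0 n
  h≡Hankel n = trans (det≡minor n (shifted 0) toℕ toℕ)
                     (cong₂ (minor (shifted 0)) (tabulate-toℕ n id) (tabulate-toℕ n id))

  minor≡Hankel : ∀ M φ ψ s k → (∀ a b → M (φ a) (ψ b) ≡ shifted s a b) →
                 minor M (applyUpTo φ k) (applyUpTo ψ k) ≡ Hankel s k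
  minor≡Hankel M φ ψ s k entries = begin
    minor M (applyUpTo φ k) (applyUpTo ψ k)        ≡⟨ cong₂ (minor M) (sym (map-upTo φ k)) (sym (map-upTo ψ k)) ⟩
    minor M (map φ (upTo k)) (map ψ (upTo k))      ≡⟨ minor-map M φ ψ (upTo k) (upTo k) ⟩
    minor (λ a b → M (φ a) (ψ b)) (upTo k) (upTo k) ≡⟨ minor-cong _ (shifted s) (upTo k) (upTo k) (λ a b _ _ → entries a b) ⟩
    Hankel s k                                      ∎
    where open ≡-Reasoning

  isEven : ℕ → Bool
  isEven zero          = true
  isEven (suc zero)    = false
  isEven (suc (suc n)) = isEven n

  isEven-suc : ∀ n → isEven (suc n) ≡ not (isEven n)
  isEven-suc zero          = refl
  isEven-suc (suc zero)    = refl
  isEven-suc (suc (suc n)) = isEven-suc n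

  evens odds : ℕ → List ℕ
  evens = applyUpTo double
  odds  = applyUpTo odd

  filterᵇ-evenPositions : ∀ (p : ℕ → Bool) (φ : ℕ → ℕ) m → (∀ i → p (φ i) ≡ isEven i) →
                          filterᵇ p (applyUpTo φ (double m)) ≡ applyUpTo (λ i → φ (double i)) m
  filterᵇ-evenPositions p φ zero    keep = refl
  filterᵇ-evenPositions p φ (suc m) keep rewrite keep 0 | keep 1 =
    cong (φ 0 ∷_) (filterᵇ-evenPositions p (λ i → φ (suc (suc i))) m (λ i → keep (suc (suc i))))

  filterᵇ-oddPositions : ∀ (p : ℕ → Bool) (φ : ℕ → ℕ) m → (∀ i → p (φ i) ≡ not (isEven i)) →
                         filterᵇ p (applyUpTo φ (double m)) ≡ applyUpTo (λ i → φ (suc (double i))) m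
  filterᵇ-oddPositions p φ zero    keep = refl
  filterᵇ-oddPositions p φ (suc m) keep rewrite keep 0 | keep 1 =
    cong (φ 1 ∷_) (filterᵇ-oddPositions p (λ i → φ (suc (suc i))) m (λ i → keep (suc (suc i))))

  partitioned-upTo-double : ∀ m → partitioned isEven (upTo (double m)) ≡ evens m ++ odds m
  partitioned-upTo-double m =
    cong₂ _++_ (filterᵇ-evenPositions isEven id m (λ _ → refl))
               (filterᵇ-oddPositions (λ i → not (isEven i)) id m (λ _ → refl))

  partitioned-upTo-suc-double : ∀ m → partitioned isEven (upTo (suc (double m))) ≡ evens (suc m) ++ odds m
  partitioned-upTo-suc-double m =
    cong₂ _++_ (cong (0 ∷_) (filterᵇ-oddPositions isEven suc m isEven-suc))
               (filterᵇ-evenPositions (λ i → not (isEven i)) suc m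
                  (λ i → trans (cong not (isEven-suc i)) (Boolₚ.not-involutive (isEven i))))

  Hankel-double : ∀ s m → Hankel s (double m) ≡ minor (shifted s) (evens m ++ odds m) (evens m ++ odds m)
  Hankel-double s m = trans (sym (minor-partition (shifted s) isEven (upTo (double m))))
                            (cong (λ rs → minor (shifted s) rs rs) (partitioned-upTo-double m))

  Hankel-suc-double : ∀ s m → Hankel s (suc (double m)) ≡
                      minor (shifted s) (evens (suc m) ++ odds m) (evens (suc m) ++ odds m)
  Hankel-suc-double s m = trans (sym (minor-partition (shifted s) isEven (upTo (suc (double m)))))
                                (cong (λ rs → minor (shifted s) rs rs) (partitioned-upTo-suc-double m))

  -- Recurrences for the shifted Hankel determinants

  f-at-double : ∀ {n} k → n ≡ double k → f n ≡ f k
  f-at-double k refl = f-double k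

  f-at-odd : ∀ {n} k → n ≡ odd (suc k) → f n ≡ 0ℤ
  f-at-odd k refl = f-odd k

  ZeroBlock-applyUpTo : ∀ M φ ψ p q → (∀ a b → M (φ a) (ψ b) ≡ 0ℤ) → ZeroBlock M (applyUpTo φ p) (applyUpTo ψ q)
  ZeroBlock-applyUpTo M φ ψ p q vanish r c i j with ∈-applyUpTo⁻ φ i | ∈-applyUpTo⁻ ψ j
  ... | a , _ , refl | b , _ , refl = vanish a b

  sgn-length-applyUpTo : ∀ (φ ψ : ℕ → ℕ) p q → sgn (length (applyUpTo φ p) ℕ.* length (applyUpTo ψ q)) ≡ sgn (p ℕ.* q)
  sgn-length-applyUpTo φ ψ p q = cong₂ (λ x y → sgn (x ℕ.* y)) (length-applyUpTo φ p) (length-applyUpTo ψ q)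

  length-applyUpTo-≤ : ∀ (φ ψ : ℕ → ℕ) p → length (applyUpTo φ p) ≤ length (applyUpTo ψ p)
  length-applyUpTo-≤ φ ψ p = ℕₚ.≤-reflexive (trans (length-applyUpTo φ p) (sym (length-applyUpTo ψ p)))

  length-applyUpTo-< : ∀ (φ ψ : ℕ → ℕ) {p q} → p < q → length (applyUpTo φ p) < length (applyUpTo ψ q)
  length-applyUpTo-< φ ψ {p} {q} = subst₂ _<_ (sym (length-applyUpTo φ p)) (sym (length-applyUpTo ψ q))

  Hankel₂-blocks : ∀ p q → minor (shifted 2) (evens p ++ odds q) (evens p ++ odds q) ≡ Hankel 1 p * Hankel 2 q
  Hankel₂-blocks p q =
    trans (minor-blockTriangular (shifted 2) (evens p) (odds q) (evens p) (odds q)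
             (ZeroBlock-applyUpTo (shifted 2) double odd p q eo) ℕₚ.≤-refl)
          (cong₂ _*_ (minor≡Hankel (shifted 2) double double 1 p ee) (minor≡Hankel (shifted 2) odd odd 2 q oo))
    where
    ee : ∀ a b → shifted 2 (double a) (double b) ≡ shifted 1 a b
    ee a b = f-at-double (suc (a ℕ.+ b)) (cong (2 ℕ.+_) (double-+ a b))
    eo : ∀ a b → shifted 2 (double a) (odd b) ≡ 0ℤ
    eo a b = f-at-odd (a ℕ.+ b) (cong (2 ℕ.+_) (double-+-suc a b))
    oo : ∀ a b → shifted 2 (odd a) (odd b) ≡ shifted 2 a b
    oo a b = f-at-double (suc (suc (a ℕ.+ b))) (cong (3 ℕ.+_) (double-+-suc a b))

  Hankel₂-double : ∀ m → Hankel 2 (double m) ≡ Hankel 1 m * Hankel 2 m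
  Hankel₂-double m = trans (Hankel-double 2 m) (Hankel₂-blocks m m)

  Hankel₂-suc-double : ∀ m → Hankel 2 (suc (double m)) ≡ Hankel 1 (suc m) * Hankel 2 m
  Hankel₂-suc-double m = trans (Hankel-suc-double 2 m) (Hankel₂-blocks (suc m) m)

  Hankel₃-double : ∀ m → Hankel 3 (double m) ≡ sgn m * (Hankel 2 m * Hankel 2 m)
  Hankel₃-double m = begin
    Hankel 3 (double m)
      ≡⟨ Hankel-double 3 m ⟩
    minor (shifted 3) (evens m ++ odds m) (evens m ++ odds m)
      ≡⟨ minor-offDiagonal (shifted 3) (evens m) (odds m)
           (ZeroBlock-applyUpTo (shifted 3) double double m m ee) (length-applyUpTo-≤ odd double m) ⟩
    sgn (length (evens m) ℕ.* length (odds m)) * (minor (shifted 3) (evens m) (odds m) * minor (shifted 3) (odds m) (evens m))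
      ≡⟨ cong₂ _*_ (trans (sgn-length-applyUpTo double odd m m) (sgn-*-self m))
                   (cong₂ _*_ (minor≡Hankel (shifted 3) double odd 2 m eo) (minor≡Hankel (shifted 3) odd double 2 m oe)) ⟩
    sgn m * (Hankel 2 m * Hankel 2 m) ∎
    where
    open ≡-Reasoning
    ee : ∀ a b → shifted 3 (double a) (double b) ≡ 0ℤ
    ee a b = f-at-odd (a ℕ.+ b) (cong (3 ℕ.+_) (double-+ a b))
    eo : ∀ a b → shifted 3 (double a) (odd b) ≡ shifted 2 a b
    eo a b = f-at-double (suc (suc (a ℕ.+ b))) (cong (3 ℕ.+_) (double-+-suc a b))
    oe : ∀ a b → shifted 3 (odd a) (double b) ≡ shifted 2 a b
    oe a b = f-at-double (suc (suc (a ℕ.+ b))) (cong (4 ℕ.+_) (double-+ a b))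

  Hankel₃-suc-double : ∀ m → Hankel 3 (suc (double m)) ≡ 0ℤ
  Hankel₃-suc-double m =
    trans (Hankel-suc-double 3 m)
          (minor-offDiagonal-<ˡ (shifted 3) (evens (suc m)) (odds m)
            (ZeroBlock-applyUpTo (shifted 3) double double (suc m) (suc m)
               (λ a b → f-at-odd (a ℕ.+ b) (cong (3 ℕ.+_) (double-+ a b))))
            (length-applyUpTo-< odd double (ℕₚ.n<1+n m)))

  evens⁺ odds⁺ : ℕ → List ℕ
  evens⁺ = applyUpTo (λ i → double (suc i))
  odds⁺  = applyUpTo (λ i → odd (suc i))

  evenCols oddCols : (ℕ → ℤ) → ℕ → ℤ
  evenCols u c = if isEven c then u c else 0ℤ
  oddCols  u c = if isEven c then 0ℤ else u c

  evenCols+oddCols : ∀ u c → u c ≡ evenCols u c + oddCols u c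
  evenCols+oddCols u c with isEven c
  ... | true  = sym (ℤₚ.+-identityʳ (u c))
  ... | false = sym (ℤₚ.+-identityˡ (u c))

  isEven-double : ∀ n → isEven (double n) ≡ true
  isEven-double zero    = refl
  isEven-double (suc n) = isEven-double n

  isEven-odd : ∀ n → isEven (odd n) ≡ false
  isEven-odd zero    = refl
  isEven-odd (suc n) = isEven-odd n

  evenCols-odd : ∀ u n → evenCols u (odd n) ≡ 0ℤ
  evenCols-odd u n rewrite isEven-odd n = refl

  oddCols-double : ∀ u n → oddCols u (double n) ≡ 0ℤ
  oddCols-double u n rewrite isEven-double n = refl

  evenCols-double : ∀ u n → evenCols u (double n) ≡ u (double n)
  evenCols-double u n rewrite isEven-double n = refl

  oddCols-odd : ∀ u n → oddCols u (odd n) ≡ u (odd n)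
  oddCols-odd u n rewrite isEven-odd n = refl

  ∈-applyUpTo-≢ : ∀ {φ : ℕ → ℕ} {x n r} → (∀ i → φ i ≢ x) → r ∈ applyUpTo φ n → r ≢ x
  ∈-applyUpTo-≢ {φ} avoid i with ∈-applyUpTo⁻ φ i
  ... | k , _ , refl = avoid k

  ∈-++-≢ : ∀ {A B : List ℕ} {x r} → (∀ {r′} → r′ ∈ A → r′ ≢ x) → (∀ {r′} → r′ ∈ B → r′ ≢ x) →
           r ∈ A ++ B → r ≢ x
  ∈-++-≢ {A} avoidA avoidB i with ∈-++⁻ A i
  ... | inj₁ i′ = avoidA i′
  ... | inj₂ i′ = avoidB i′

  ∉-evens⁺++odds : ∀ p q {r} → r ∈ evens⁺ p ++ odds q → r ≢ 0
  ∉-evens⁺++odds p q = ∈-++-≢ {A = evens⁺ p} (∈-applyUpTo-≢ {n = p} (λ _ ())) (∈-applyUpTo-≢ {n = q} (λ _ ()))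

  module _ where
    private
      M = shifted 1
      Mᵉ = withRow M 0 (evenCols (M 0))
      Mᵒ = withRow M 0 (oddCols (M 0))

      L : ℕ → ℕ → List ℕ
      L p q = evens (suc p) ++ odds q

      split : ∀ p q → minor M (L p q) (L p q) ≡ minor Mᵉ (L p q) (L p q) + minor Mᵒ (L p q) (L p q)
      split p q = minor-splitRow M 0 (evenCols (M 0)) (oddCols (M 0)) (evens⁺ p ++ odds q) (L p q)
                    (evenCols+oddCols (M 0)) (∉-evens⁺++odds p q)

      evenPart : ∀ p q → minor Mᵉ (L p q) (L p q) ≡ - minor M (evens⁺ p ++ odds q) (evens⁺ p ++ odds q)
      evenPart p q = begin
        minor Mᵉ (0 ∷ R) ([] ++ 0 ∷ R)
          ≡⟨ minor-expandSparseRow Mᵉ 0 R [] 0 R (λ ()) sparse ⟩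
        1ℤ * (- 1ℤ * minor Mᵉ R R)
          ≡⟨ trans (ℤₚ.*-identityˡ _) (ℤₚ.-1*i≡-i _) ⟩
        - minor Mᵉ R R
          ≡⟨ cong -_ (minor-withRow M 0 (evenCols (M 0)) R R (∉-evens⁺++odds p q)) ⟩
        - minor M R R ∎
        where
        open ≡-Reasoning
        R = evens⁺ p ++ odds q
        sparse : ∀ {c} → c ∈ R → Mᵉ 0 c ≡ 0ℤ
        sparse i with ∈-++⁻ (evens⁺ p) i
        ... | inj₁ i′ with ∈-applyUpTo⁻ _ i′
        ...   | b , _ , refl = trans (evenCols-double (M 0) (suc b)) (f-odd b)
        sparse i | inj₂ i′ with ∈-applyUpTo⁻ _ i′
        ...   | b , _ , refl = evenCols-odd (M 0) b

      evens⁺-zero : ∀ p → ZeroBlock M (evens⁺ p) (evens⁺ p)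
      evens⁺-zero p = ZeroBlock-applyUpTo M _ _ p p
        (λ a b → f-at-odd (a ℕ.+ suc b) (cong (1 ℕ.+_) (double-+ (suc a) (suc b))))

      odds-zero : ∀ q → ZeroBlock M (odds q) (odds q)
      odds-zero q = ZeroBlock-applyUpTo M odd odd q q (λ a b → f-at-odd (a ℕ.+ b) (cong (2 ℕ.+_) (double-+-suc a b)))

      evensᵒ-zero : ∀ p → ZeroBlock Mᵒ (evens p) (evens p)
      evensᵒ-zero p = ZeroBlock-applyUpTo Mᵒ double double p p vanish
        where
        vanish : ∀ a b → Mᵒ (double a) (double b) ≡ 0ℤ
        vanish 0       b = oddCols-double (M 0) b
        vanish (suc a) b = f-at-odd (a ℕ.+ b) (cong (3 ℕ.+_) (double-+ a b))

    Hankel₁-suc-double : ∀ m → Hankel 1 (suc (double m)) ≡ - (sgn m * (Hankel 2 m * Hankel 2 m))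
    Hankel₁-suc-double m = begin
      Hankel 1 (suc (double m))
        ≡⟨ trans (Hankel-suc-double 1 m) (split m m) ⟩
      minor Mᵉ (L m m) (L m m) + minor Mᵒ (L m m) (L m m)
        ≡⟨ cong₂ _+_ (evenPart m m)
             (minor-offDiagonal-<ˡ Mᵒ (evens (suc m)) (odds m) (evensᵒ-zero (suc m))
               (length-applyUpTo-< odd double (ℕₚ.n<1+n m))) ⟩
      - minor M (evens⁺ m ++ odds m) (evens⁺ m ++ odds m) + 0ℤ
        ≡⟨ trans (ℤₚ.+-identityʳ _) (cong -_ (minor-offDiagonal M (evens⁺ m) (odds m) (evens⁺-zero m)
             (length-applyUpTo-≤ odd _ m))) ⟩
      - (sgn (length (evens⁺ m) ℕ.* length (odds m)) * (minor M (evens⁺ m) (odds m) * minor M (odds m) (evens⁺ m)))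
        ≡⟨ cong -_ (cong₂ _*_ (trans (sgn-length-applyUpTo _ odd m m) (sgn-*-self m))
             (cong₂ _*_ (minor≡Hankel M _ odd 2 m eo) (minor≡Hankel M odd _ 2 m oe))) ⟩
      - (sgn m * (Hankel 2 m * Hankel 2 m)) ∎
      where
      open ≡-Reasoning
      eo : ∀ a b → M (double (suc a)) (odd b) ≡ shifted 2 a b
      eo a b = f-at-double (suc (suc (a ℕ.+ b))) (cong (1 ℕ.+_) (double-+-suc (suc a) b))
      oe : ∀ a b → M (odd a) (double (suc b)) ≡ shifted 2 a b
      oe a b = trans (f-at-double (suc (a ℕ.+ suc b)) (cong (2 ℕ.+_) (double-+ a (suc b))))
                     (cong (λ k → f (suc k)) (ℕₚ.+-suc a b))

    Hankel₁-double-suc : ∀ m → Hankel 1 (double (suc m)) ≡ sgn (suc m) * (Hankel 1 (suc m) * Hankel 1 (suc m))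
    Hankel₁-double-suc m = begin
      Hankel 1 (double (suc m))
        ≡⟨ trans (Hankel-double 1 (suc m)) (split m (suc m)) ⟩
      minor Mᵉ (L m (suc m)) (L m (suc m)) + minor Mᵒ (L m (suc m)) (L m (suc m))
        ≡⟨ cong₂ _+_
             (trans (evenPart m (suc m)) (cong -_ (minor-offDiagonal-<ʳ M (evens⁺ m) (odds (suc m)) (odds-zero (suc m))
               (length-applyUpTo-< _ odd (ℕₚ.n<1+n m)))))
             (minor-offDiagonal Mᵒ (evens (suc m)) (odds (suc m)) (evensᵒ-zero (suc m))
               (length-applyUpTo-≤ odd double (suc m))) ⟩
      - 0ℤ + sgn (length (evens (suc m)) ℕ.* length (odds (suc m))) * (minor Mᵒ E O * minor Mᵒ O E)
        ≡⟨ trans (ℤₚ.+-identityˡ _) (cong₂ _*_ (trans (sgn-length-applyUpTo double odd (suc m) (suc m)) (sgn-*-self (suc m)))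
             (cong₂ _*_ (minor≡Hankel Mᵒ double odd 1 (suc m) eo) (minor≡Hankel Mᵒ odd double 1 (suc m) oe))) ⟩
      sgn (suc m) * (Hankel 1 (suc m) * Hankel 1 (suc m)) ∎
      where
      open ≡-Reasoning
      E = evens (suc m)
      O = odds (suc m)
      eo : ∀ a b → Mᵒ (double a) (odd b) ≡ shifted 1 a b
      eo 0       b = trans (oddCols-odd (M 0) b) (f-double (suc b))
      eo (suc a) b = f-at-double (suc (suc a ℕ.+ b)) (cong (1 ℕ.+_) (double-+-suc (suc a) b))
      oe : ∀ a b → Mᵒ (odd a) (double b) ≡ shifted 1 a b
      oe a b = f-at-double (suc (a ℕ.+ b)) (cong (2 ℕ.+_) (double-+ a b))

  sgn-suc-*-* : ∀ p q → sgn (suc p) * (sgn (p ℕ.* suc q) * sgn (p ℕ.* q)) ≡ - 1ℤ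
  sgn-suc-*-* p q = begin
    sgn (suc p) * (sgn (p ℕ.* suc q) * sgn (p ℕ.* q))
      ≡⟨ cong₂ (λ x y → x * (y * sgn (p ℕ.* q))) (sgn-suc p) (sgn-*-suc p q) ⟩
    - sgn p * (sgn p * sgn (p ℕ.* q) * sgn (p ℕ.* q))
      ≡⟨ regroup (sgn p) (sgn (p ℕ.* q)) ⟩
    - (sgn p * sgn p * (sgn (p ℕ.* q) * sgn (p ℕ.* q)))
      ≡⟨ cong₂ (λ x y → - (x * y)) (sgn-square p) (sgn-square (p ℕ.* q)) ⟩
    - 1ℤ ∎
    where
    open ≡-Reasoning
    regroup : ∀ (a b : ℤ) → - a * (a * b * b) ≡ - (a * a * (b * b))
    regroup = solve-∀

  module _ where
    private
      M = shifted 0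
      Mᵉ = withRow M 0 (evenCols (M 0))
      Mᵒ = withRow M 0 (oddCols (M 0))
      M₁ᵉ = withRow M 1 (evenCols (M 1))
      M₁ᵒ = withRow M 1 (oddCols (M 1))

      L : ℕ → ℕ → List ℕ
      L p q = evens (suc p) ++ odds (suc q)

      -- The columns left after deleting column 1.
      C : ℕ → ℕ → List ℕ
      C p q = evens (suc p) ++ odds⁺ q

      R₁ : ℕ → ℕ → List ℕ
      R₁ p q = odds (suc q) ++ evens⁺ p

      ∉-odds⁺++evens⁺ : ∀ p q {r} → r ∈ odds⁺ q ++ evens⁺ p → r ≢ 1
      ∉-odds⁺++evens⁺ p q = ∈-++-≢ {A = odds⁺ q} (∈-applyUpTo-≢ {n = q} (λ _ ())) (∈-applyUpTo-≢ {n = p} (λ _ ()))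

      evenPart : ∀ p q → minor Mᵉ (L p q) (L p q) ≡ Hankel 0 (suc p) * Hankel 1 (suc q)
      evenPart p q =
        trans (minor-blockTriangular Mᵉ (evens (suc p)) (odds (suc q)) (evens (suc p)) (odds (suc q))
                 (ZeroBlock-applyUpTo Mᵉ double odd (suc p) (suc q) eo) ℕₚ.≤-refl)
              (cong₂ _*_ (minor≡Hankel Mᵉ double double 0 (suc p) ee) (minor≡Hankel Mᵉ odd odd 1 (suc q) oo))
        where
        eo : ∀ a b → Mᵉ (double a) (odd b) ≡ 0ℤ
        eo 0       b = evenCols-odd (M 0) b
        eo (suc a) b = f-at-odd (a ℕ.+ b) (double-+-suc (suc a) b)
        ee : ∀ a b → Mᵉ (double a) (double b) ≡ shifted 0 a b
        ee 0       b = trans (evenCols-double (M 0) b) (f-double b)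
        ee (suc a) b = f-at-double (suc a ℕ.+ b) (double-+ (suc a) b)
        oo : ∀ a b → Mᵉ (odd a) (odd b) ≡ shifted 1 a b
        oo a b = f-at-double (suc (a ℕ.+ b)) (cong suc (double-+-suc a b))

      oddPart : ∀ p q → minor Mᵒ (L p q) (L p q) ≡ - (sgn (suc p) * minor M (evens⁺ p ++ odds (suc q)) (C p q))
      oddPart p q = begin
        minor Mᵒ (0 ∷ R) (evens (suc p) ++ 1 ∷ odds⁺ q)
          ≡⟨ minor-expandSparseRow Mᵒ 0 R (evens (suc p)) 1 (odds⁺ q) evenCol oddCol ⟩
        sgn (length (evens (suc p))) * (- 1ℤ * minor Mᵒ R (C p q))
          ≡⟨ cong₂ (λ n x → sgn n * (- 1ℤ * x)) (length-applyUpTo double (suc p))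
                   (minor-withRow M 0 (oddCols (M 0)) R (C p q) (∉-evens⁺++odds p (suc q))) ⟩
        sgn (suc p) * (- 1ℤ * minor M R (C p q))
          ≡⟨ cong (sgn (suc p) *_) (ℤₚ.-1*i≡-i _) ⟩
        sgn (suc p) * - minor M R (C p q)
          ≡⟨ sym (ℤₚ.neg-distribʳ-* (sgn (suc p)) _) ⟩
        - (sgn (suc p) * minor M R (C p q)) ∎
        where
        open ≡-Reasoning
        R = evens⁺ p ++ odds (suc q)
        evenCol : ∀ {c} → c ∈ evens (suc p) → Mᵒ 0 c ≡ 0ℤ
        evenCol i with ∈-applyUpTo⁻ double i
        ... | b , _ , refl = oddCols-double (M 0) b
        oddCol : ∀ {c} → c ∈ odds⁺ q → Mᵒ 0 c ≡ 0ℤ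
        oddCol i with ∈-applyUpTo⁻ _ i
        ... | b , _ , refl = trans (oddCols-odd (M 0) (suc b)) (f-odd b)

      row₁EvenPart : ∀ p q → minor M₁ᵉ (R₁ p q) (C p q) ≡ - (sgn (p ℕ.* q) * (Hankel 3 q * Hankel 2 p))
      row₁EvenPart p q = begin
        minor M₁ᵉ (1 ∷ R) ([] ++ 0 ∷ evens⁺ p ++ odds⁺ q)
          ≡⟨ minor-expandSparseRow M₁ᵉ 1 R [] 0 (evens⁺ p ++ odds⁺ q) (λ ()) sparse ⟩
        1ℤ * (- 1ℤ * minor M₁ᵉ R (evens⁺ p ++ odds⁺ q))
          ≡⟨ trans (ℤₚ.*-identityˡ _) (ℤₚ.-1*i≡-i _) ⟩
        - minor M₁ᵉ R (evens⁺ p ++ odds⁺ q)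
          ≡⟨ cong -_ (minor-withRow M 1 (evenCols (M 1)) R _ (∉-odds⁺++evens⁺ p q)) ⟩
        - minor M R ([] ++ evens⁺ p ++ odds⁺ q)
          ≡⟨ cong -_ (minor-swapColBlocks M R [] (evens⁺ p) (odds⁺ q) (↭-length (++-comm (odds⁺ q) (evens⁺ p)))) ⟩
        - (sgn (length (evens⁺ p) ℕ.* length (odds⁺ q)) * minor M (odds⁺ q ++ evens⁺ p) (odds⁺ q ++ evens⁺ p))
          ≡⟨ cong -_ (cong₂ _*_ (sgn-length-applyUpTo _ _ p q)
               (minor-blockTriangular M (odds⁺ q) (evens⁺ p) (odds⁺ q) (evens⁺ p)
                 (ZeroBlock-applyUpTo M _ _ q p oe) ℕₚ.≤-refl)) ⟩
        - (sgn (p ℕ.* q) * (minor M (odds⁺ q) (odds⁺ q) * minor M (evens⁺ p) (evens⁺ p)))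
          ≡⟨ cong (λ x → - (sgn (p ℕ.* q) * x))
               (cong₂ _*_ (minor≡Hankel M _ _ 3 q oo) (minor≡Hankel M _ _ 2 p ee)) ⟩
        - (sgn (p ℕ.* q) * (Hankel 3 q * Hankel 2 p)) ∎
        where
        open ≡-Reasoning
        R = odds⁺ q ++ evens⁺ p
        sparse : ∀ {c} → c ∈ evens⁺ p ++ odds⁺ q → M₁ᵉ 1 c ≡ 0ℤ
        sparse i with ∈-++⁻ (evens⁺ p) i
        ... | inj₁ i′ with ∈-applyUpTo⁻ _ i′
        ...   | b , _ , refl = trans (evenCols-double (M 1) (suc b)) (f-odd b)
        sparse i | inj₂ i′ with ∈-applyUpTo⁻ _ i′
        ...   | b , _ , refl = evenCols-odd (M 1) (suc b)
        oe : ∀ a b → M (odd (suc a)) (double (suc b)) ≡ 0ℤ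
        oe a b = f-at-odd (a ℕ.+ suc b) (cong suc (double-+ (suc a) (suc b)))
        oo : ∀ a b → M (odd (suc a)) (odd (suc b)) ≡ shifted 3 a b
        oo a b = trans (f-at-double (suc (suc a ℕ.+ suc b)) (cong suc (double-+-suc (suc a) (suc b))))
                       (cong (λ k → f (suc (suc k))) (ℕₚ.+-suc a b))
        ee : ∀ a b → M (double (suc a)) (double (suc b)) ≡ shifted 2 a b
        ee a b = trans (f-at-double (suc a ℕ.+ suc b) (double-+ (suc a) (suc b)))
                       (cong (λ k → f (suc k)) (ℕₚ.+-suc a b))

      row₁OddPart : ∀ p q → minor M₁ᵒ (R₁ p q) (C p q) ≡ 0ℤ
      row₁OddPart p q =
        trans (minor-swapColBlocks M₁ᵒ R [] (evens (suc p)) (odds⁺ q) (cong suc (↭-length (++-comm (odds⁺ q) (evens⁺ p)))))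
              (trans (cong (sgn (length (evens (suc p)) ℕ.* length (odds⁺ q)) *_)
                       (minor-deficient M₁ᵒ (odds (suc q)) (evens⁺ p) (odds⁺ q) (evens (suc p))
                         (ZeroBlock-applyUpTo M₁ᵒ odd double (suc q) (suc p) vanish)
                         (length-applyUpTo-< _ odd (ℕₚ.n<1+n q))))
                     (ℤₚ.*-zeroʳ (sgn (length (evens (suc p)) ℕ.* length (odds⁺ q)))))
        where
        R = odds (suc q) ++ evens⁺ p
        vanish : ∀ a b → M₁ᵒ (odd a) (double b) ≡ 0ℤ
        vanish 0       b = oddCols-double (M 1) b
        vanish (suc a) b = f-at-odd (a ℕ.+ b) (cong suc (double-+ (suc a) b))

      row₁ : ∀ p q → minor M (R₁ p q) (C p q) ≡ - (sgn (p ℕ.* q) * (Hankel 3 q * Hankel 2 p))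
      row₁ p q = begin
        minor M (R₁ p q) (C p q)
          ≡⟨ minor-splitRow M 1 (evenCols (M 1)) (oddCols (M 1)) (odds⁺ q ++ evens⁺ p) (C p q)
               (evenCols+oddCols (M 1)) (∉-odds⁺++evens⁺ p q) ⟩
        minor M₁ᵉ (R₁ p q) (C p q) + minor M₁ᵒ (R₁ p q) (C p q)
          ≡⟨ cong₂ _+_ (row₁EvenPart p q) (row₁OddPart p q) ⟩
        - (sgn (p ℕ.* q) * (Hankel 3 q * Hankel 2 p)) + 0ℤ
          ≡⟨ ℤₚ.+-identityʳ _ ⟩
        - (sgn (p ℕ.* q) * (Hankel 3 q * Hankel 2 p)) ∎
        where open ≡-Reasoning

    Hankel₀-blocks : ∀ p q → minor (shifted 0) (L p q) (L p q) ≡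
                             Hankel 0 (suc p) * Hankel 1 (suc q) - Hankel 2 p * Hankel 3 q
    Hankel₀-blocks p q = begin
      minor M (L p q) (L p q)
        ≡⟨ minor-splitRow M 0 (evenCols (M 0)) (oddCols (M 0)) (evens⁺ p ++ odds (suc q)) (L p q)
             (evenCols+oddCols (M 0)) (∉-evens⁺++odds p (suc q)) ⟩
      minor Mᵉ (L p q) (L p q) + minor Mᵒ (L p q) (L p q)
        ≡⟨ cong₂ _+_ (evenPart p q) (oddPart p q) ⟩
      A + - (sgn (suc p) * minor M (evens⁺ p ++ odds (suc q)) (C p q))
        ≡⟨ cong (λ x → A + - (sgn (suc p) * x))
             (trans (minor-swapRowBlocks M (evens⁺ p) (odds (suc q)) (C p q))
                    (cong₂ _*_ (sgn-length-applyUpTo _ odd p (suc q)) (row₁ p q))) ⟩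
      A + - (sgn (suc p) * (sgn (p ℕ.* suc q) * - (sgn (p ℕ.* q) * (Hankel 3 q * Hankel 2 p))))
        ≡⟨ collect A (sgn (suc p)) (sgn (p ℕ.* suc q)) (sgn (p ℕ.* q)) (Hankel 3 q) (Hankel 2 p) ⟩
      A + sgn (suc p) * (sgn (p ℕ.* suc q) * sgn (p ℕ.* q)) * (Hankel 2 p * Hankel 3 q)
        ≡⟨ cong (λ s → A + s * (Hankel 2 p * Hankel 3 q)) (sgn-suc-*-* p q) ⟩
      A + - 1ℤ * (Hankel 2 p * Hankel 3 q)
        ≡⟨ cong (A +_) (ℤₚ.-1*i≡-i _) ⟩
      A - Hankel 2 p * Hankel 3 q ∎
      where
      open ≡-Reasoning
      A = Hankel 0 (suc p) * Hankel 1 (suc q)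
      collect : ∀ (A s₁ s₂ s₃ x y : ℤ) →
                A + - (s₁ * (s₂ * - (s₃ * (x * y)))) ≡ A + s₁ * (s₂ * s₃) * (y * x)
      collect = solve-∀

  Hankel₀-double-suc : ∀ m → Hankel 0 (double (suc m)) ≡ Hankel 0 (suc m) * Hankel 1 (suc m) - Hankel 2 m * Hankel 3 m
  Hankel₀-double-suc m = trans (Hankel-double 0 (suc m)) (Hankel₀-blocks m m)

  Hankel₀-suc-double-suc : ∀ m → Hankel 0 (suc (double (suc m))) ≡
                           Hankel 0 (suc (suc m)) * Hankel 1 (suc m) - Hankel 2 (suc m) * Hankel 3 m
  Hankel₀-suc-double-suc m = trans (Hankel-suc-double 0 (suc m)) (Hankel₀-blocks (suc m) m)

  -- Signs and positivity

  IsUnit : ℤ → Set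
  IsUnit x = x ≡ 1ℤ ⊎ x ≡ - 1ℤ

  IsUnit-square : ∀ {x} → IsUnit x → x * x ≡ 1ℤ
  IsUnit-square (inj₁ refl) = refl
  IsUnit-square (inj₂ refl) = refl

  IsUnit-* : ∀ {x y} → IsUnit x → IsUnit y → IsUnit (x * y)
  IsUnit-* (inj₁ refl) (inj₁ refl) = inj₁ refl
  IsUnit-* (inj₁ refl) (inj₂ refl) = inj₂ refl
  IsUnit-* (inj₂ refl) (inj₁ refl) = inj₂ refl
  IsUnit-* (inj₂ refl) (inj₂ refl) = inj₁ refl

  IsUnit-neg : ∀ {x} → IsUnit x → IsUnit (- x)
  IsUnit-neg (inj₁ refl) = inj₂ refl
  IsUnit-neg (inj₂ refl) = inj₁ refl

  IsUnit-sgn : ∀ n → IsUnit (sgn n)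
  IsUnit-sgn zero          = inj₁ refl
  IsUnit-sgn (suc zero)    = inj₂ refl
  IsUnit-sgn (suc (suc n)) = IsUnit-sgn n

  *-square-unit : ∀ x {y} → IsUnit y → x * (y * y) ≡ x
  *-square-unit x u = trans (cong (x *_) (IsUnit-square u)) (ℤₚ.*-identityʳ x)

  Hankel₁₂-units : ∀ n → IsUnit (Hankel 1 n) × IsUnit (Hankel 2 n)
  Hankel₁₂-units = <-rec _ step
    where
    step : ∀ n → (∀ {k} → k < n → IsUnit (Hankel 1 k) × IsUnit (Hankel 2 k)) → IsUnit (Hankel 1 n) × IsUnit (Hankel 2 n)
    step n rec with half n
    ... | twice 0         = inj₁ refl , inj₁ refl
    ... | twice+1 0       = inj₂ refl , inj₂ refl
    ... | twice (suc m)   =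
      subst IsUnit (sym (trans (Hankel₁-double-suc m) (*-square-unit _ b))) (IsUnit-sgn (suc m)) ,
      subst IsUnit (sym (Hankel₂-double (suc m))) (IsUnit-* b c)
      where
      b = proj₁ (rec (s≤s (s≤s (m≤double m))))
      c = proj₂ (rec (s≤s (s≤s (m≤double m))))
    ... | twice+1 (suc m) =
      subst IsUnit (sym (trans (Hankel₁-suc-double (suc m)) (cong -_ (*-square-unit _ c)))) (IsUnit-neg (IsUnit-sgn (suc m))) ,
      subst IsUnit (sym (Hankel₂-suc-double (suc m))) (IsUnit-* b c)
      where
      b = proj₁ (rec (s≤s (s≤s (s≤s (m≤double m)))))
      c = proj₂ (rec (s≤s (s≤s (ℕₚ.m≤n⇒m≤1+n (m≤double m)))))

  Hankel₁-double≡sgn : ∀ m → Hankel 1 (double m) ≡ sgn m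
  Hankel₁-double≡sgn zero    = refl
  Hankel₁-double≡sgn (suc m) = trans (Hankel₁-double-suc m) (*-square-unit _ (proj₁ (Hankel₁₂-units (suc m))))

  Hankel₁-suc-double≡-sgn : ∀ m → Hankel 1 (suc (double m)) ≡ - sgn m
  Hankel₁-suc-double≡-sgn m = trans (Hankel₁-suc-double m) (cong -_ (*-square-unit _ (proj₂ (Hankel₁₂-units m))))

  Hankel₃-double≡sgn : ∀ m → Hankel 3 (double m) ≡ sgn m
  Hankel₃-double≡sgn m = trans (Hankel₃-double m) (*-square-unit _ (proj₂ (Hankel₁₂-units m)))

  positive-step : ∀ P t r s → t * t ≡ 1ℤ → r * r ≡ 1ℤ → 0ℤ ℤ.< P * r → s * t ℤ.≤ 0ℤ →
                  0ℤ ℤ.< (P * t - r * s) * (t * r)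
  positive-step P t r s t²≡1 r²≡1 0<Pr st≤0 =
    subst (0ℤ ℤ.<_) (sym expand) (ℤₚ.+-mono-<-≤ 0<Pr (ℤₚ.neg-mono-≤ st≤0))
    where
    expand : (P * t - r * s) * (t * r) ≡ P * r - s * t
    expand = begin
      (P * t - r * s) * (t * r)             ≡⟨ distribute P t r s ⟩
      P * r * (t * t) - r * r * (s * t)     ≡⟨ cong₂ (λ x y → P * r * x - y * (s * t)) t²≡1 r²≡1 ⟩
      P * r * 1ℤ - 1ℤ * (s * t)             ≡⟨ cong₂ _-_ (ℤₚ.*-identityʳ (P * r)) (ℤₚ.*-identityˡ (s * t)) ⟩
      P * r - s * t                         ∎
      where
      open ≡-Reasoning
      distribute : ∀ (P t r s : ℤ) → (P * t - r * s) * (t * r) ≡ P * r * (t * t) - r * r * (s * t)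
      distribute = solve-∀

  Hankel₃₁-nonpositive : ∀ m → Hankel 3 m * Hankel 1 (suc m) ℤ.≤ 0ℤ
  Hankel₃₁-nonpositive m with half m
  ... | twice j   = subst (ℤ._≤ 0ℤ) (sym (cong₂ _*_ (Hankel₃-double≡sgn j) (Hankel₁-suc-double≡-sgn j)))
                      (subst (ℤ._≤ 0ℤ) (trans (cong -_ (sym (sgn-square j))) (ℤₚ.neg-distribʳ-* (sgn j) (sgn j))) (ℤ.-≤+))
  ... | twice+1 j = ℤₚ.≤-reflexive (cong (_* Hankel 1 (suc (suc (double j)))) (Hankel₃-suc-double j))

  Hankel₀₂-positive : ∀ k → 0ℤ ℤ.< Hankel 0 (suc k) * Hankel 2 k
  Hankel₀₂-positive = <-rec _ step
    where
    step : ∀ k → (∀ {j} → j < k → 0ℤ ℤ.< Hankel 0 (suc j) * Hankel 2 j) → 0ℤ ℤ.< Hankel 0 (suc k) * Hankel 2 k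
    step k rec with half k
    ... | twice 0         = ℤ.+<+ (s≤s z≤n)
    ... | twice+1 m       =
      subst (0ℤ ℤ.<_) (sym (cong₂ _*_ (Hankel₀-double-suc m) (Hankel₂-suc-double m)))
        (positive-step (Hankel 0 (suc m)) (Hankel 1 (suc m)) (Hankel 2 m) (Hankel 3 m)
          (IsUnit-square (proj₁ (Hankel₁₂-units (suc m)))) (IsUnit-square (proj₂ (Hankel₁₂-units m)))
          (rec (s≤s (m≤double m))) (Hankel₃₁-nonpositive m))
    ... | twice (suc m)   =
      subst (0ℤ ℤ.<_) (sym (cong₂ _*_ (Hankel₀-suc-double-suc m) (Hankel₂-double (suc m))))
        (positive-step (Hankel 0 (suc (suc m))) (Hankel 1 (suc m)) (Hankel 2 (suc m)) (Hankel 3 m)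
          (IsUnit-square (proj₁ (Hankel₁₂-units (suc m)))) (IsUnit-square (proj₂ (Hankel₁₂-units (suc m))))
          (rec (s≤s (s≤s (m≤double m)))) (Hankel₃₁-nonpositive m))

  ⁺≡+unit : ∀ x {u} → IsUnit u → 0ℤ ℤ.< x * u → x ⁺ ≡ x + u
  ⁺≡+unit x (inj₁ refl) 0<x*1 with x ℤ.≤ᵇ 0ℤ in eq
  ... | true  = ⊥-elim (ℤₚ.<⇒≱ (subst (0ℤ ℤ.<_) (ℤₚ.*-identityʳ x) 0<x*1) (ℤₚ.≤ᵇ⇒≤ (subst T (sym eq) tt)))
  ... | false = refl
  ⁺≡+unit x (inj₂ refl) 0<x*-1 with x ℤ.≤ᵇ 0ℤ in eq
  ... | true  = refl
  ... | false = ⊥-elim (subst T eq (ℤₚ.≤⇒≤ᵇ (ℤₚ.<⇒≤ x<0)))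
    where
    x<0 : x ℤ.< 0ℤ
    x<0 = subst (ℤ._< 0ℤ) (ℤₚ.neg-involutive x)
            (ℤₚ.neg-mono-< (subst (0ℤ ℤ.<_) (trans (ℤₚ.*-comm x (- 1ℤ)) (ℤₚ.-1*i≡-i x)) 0<x*-1))

  -- The eight identities

  sub-*-cong : ∀ a c {b b′ d d′ : ℤ} → b ≡ b′ → d ≡ d′ → a * b - c * d ≡ a * b′ - c * d′
  sub-*-cong a c = cong₂ (λ b d → a * b - c * d)

  Hankel₁[4N] : ∀ N → Hankel 1 (double (double N)) ≡ 1ℤ
  Hankel₁[4N] N = trans (Hankel₁-double≡sgn (double N)) (sgn-double N)

  Hankel₁[4N+1] : ∀ N → Hankel 1 (suc (double (double N))) ≡ - 1ℤ
  Hankel₁[4N+1] N = trans (Hankel₁-suc-double≡-sgn (double N)) (cong -_ (sgn-double N))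

  Hankel₁[4N+2] : ∀ N → Hankel 1 (double (odd N)) ≡ - 1ℤ
  Hankel₁[4N+2] N = trans (Hankel₁-double≡sgn (odd N)) (sgn-odd N)

  Hankel₁[4N+3] : ∀ N → Hankel 1 (suc (double (odd N))) ≡ 1ℤ
  Hankel₁[4N+3] N = trans (Hankel₁-suc-double≡-sgn (odd N)) (cong -_ (sgn-odd N))

  Hankel₃[4N] : ∀ N → Hankel 3 (double (double N)) ≡ 1ℤ
  Hankel₃[4N] N = trans (Hankel₃-double≡sgn (double N)) (sgn-double N)

  Hankel₃[4N+2] : ∀ N → Hankel 3 (double (odd N)) ≡ - 1ℤ
  Hankel₃[4N+2] N = trans (Hankel₃-double≡sgn (odd N)) (sgn-odd N)

  Hankel₀-⁺ : ∀ j → Hankel 0 (suc (suc j)) + Hankel 2 (suc j) ≡ Hankel 0 (suc (suc j)) ⁺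
  Hankel₀-⁺ j = sym (⁺≡+unit (Hankel 0 (suc (suc j))) (proj₂ (Hankel₁₂-units (suc j))) (Hankel₀₂-positive (suc j)))

  module _ (N : ℕ) where
    private
      k = double (double N)

    Hankel₀[8N+3] : Hankel 0 (3 ℕ.+ double k) ≡ - (Hankel 0 (2 ℕ.+ k)) ⁺
    Hankel₀[8N+3] = begin
      Hankel 0 (suc (double (suc k)))
        ≡⟨ Hankel₀-suc-double-suc k ⟩
      Hankel 0 (suc (suc k)) * Hankel 1 (suc k) - Hankel 2 (suc k) * Hankel 3 k
        ≡⟨ sub-*-cong (Hankel 0 (suc (suc k))) (Hankel 2 (suc k)) (Hankel₁[4N+1] N) (Hankel₃[4N] N) ⟩
      Hankel 0 (suc (suc k)) * - 1ℤ - Hankel 2 (suc k) * 1ℤ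
        ≡⟨ simplify (Hankel 0 (suc (suc k))) (Hankel 2 (suc k)) ⟩
      - (Hankel 0 (suc (suc k)) + Hankel 2 (suc k))
        ≡⟨ cong -_ (Hankel₀-⁺ k) ⟩
      - (Hankel 0 (suc (suc k)) ⁺) ∎
      where
      open ≡-Reasoning
      simplify : ∀ (a c : ℤ) → a * - 1ℤ - c * 1ℤ ≡ - (a + c)
      simplify = solve-∀

    Hankel₀[8N+4] : Hankel 0 (4 ℕ.+ double k) ≡ - Hankel 0 (2 ℕ.+ k)
    Hankel₀[8N+4] = begin
      Hankel 0 (double (suc (suc k)))
        ≡⟨ Hankel₀-double-suc (suc k) ⟩
      Hankel 0 (suc (suc k)) * Hankel 1 (suc (suc k)) - Hankel 2 (suc k) * Hankel 3 (suc k)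
        ≡⟨ sub-*-cong (Hankel 0 (suc (suc k))) (Hankel 2 (suc k)) (Hankel₁[4N+2] N) (Hankel₃-suc-double (double N)) ⟩
      Hankel 0 (suc (suc k)) * - 1ℤ - Hankel 2 (suc k) * 0ℤ
        ≡⟨ simplify (Hankel 0 (suc (suc k))) (Hankel 2 (suc k)) ⟩
      - Hankel 0 (suc (suc k)) ∎
      where
      open ≡-Reasoning
      simplify : ∀ (a c : ℤ) → a * - 1ℤ - c * 0ℤ ≡ - a
      simplify = solve-∀

    Hankel₀[8N+5] : Hankel 0 (5 ℕ.+ double k) ≡ - Hankel 0 (3 ℕ.+ k)
    Hankel₀[8N+5] = begin
      Hankel 0 (suc (double (suc (suc k))))
        ≡⟨ Hankel₀-suc-double-suc (suc k) ⟩
      Hankel 0 (suc (suc (suc k))) * Hankel 1 (suc (suc k)) - Hankel 2 (suc (suc k)) * Hankel 3 (suc k)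
        ≡⟨ sub-*-cong (Hankel 0 (suc (suc (suc k)))) (Hankel 2 (suc (suc k))) (Hankel₁[4N+2] N) (Hankel₃-suc-double (double N)) ⟩
      Hankel 0 (suc (suc (suc k))) * - 1ℤ - Hankel 2 (suc (suc k)) * 0ℤ
        ≡⟨ simplify (Hankel 0 (suc (suc (suc k)))) (Hankel 2 (suc (suc k))) ⟩
      - Hankel 0 (suc (suc (suc k))) ∎
      where
      open ≡-Reasoning
      simplify : ∀ (a c : ℤ) → a * - 1ℤ - c * 0ℤ ≡ - a
      simplify = solve-∀

    Hankel₀[8N+6] : Hankel 0 (6 ℕ.+ double k) ≡ (Hankel 0 (3 ℕ.+ k)) ⁺
    Hankel₀[8N+6] = begin
      Hankel 0 (double (suc (suc (suc k))))
        ≡⟨ Hankel₀-double-suc (suc (suc k)) ⟩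
      Hankel 0 (suc (suc (suc k))) * Hankel 1 (suc (suc (suc k))) - Hankel 2 (suc (suc k)) * Hankel 3 (suc (suc k))
        ≡⟨ sub-*-cong (Hankel 0 (suc (suc (suc k)))) (Hankel 2 (suc (suc k))) (Hankel₁[4N+3] N) (Hankel₃[4N+2] N) ⟩
      Hankel 0 (suc (suc (suc k))) * 1ℤ - Hankel 2 (suc (suc k)) * - 1ℤ
        ≡⟨ simplify (Hankel 0 (suc (suc (suc k)))) (Hankel 2 (suc (suc k))) ⟩
      Hankel 0 (suc (suc (suc k))) + Hankel 2 (suc (suc k))
        ≡⟨ Hankel₀-⁺ (suc k) ⟩
      Hankel 0 (suc (suc (suc k))) ⁺ ∎
      where
      open ≡-Reasoning
      simplify : ∀ (a c : ℤ) → a * 1ℤ - c * - 1ℤ ≡ a + c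
      simplify = solve-∀

    Hankel₀[8N+7] : Hankel 0 (7 ℕ.+ double k) ≡ Hankel 0 (3 ℕ.+ k)
    Hankel₀[8N+7] = begin
      Hankel 0 (suc (double (suc (suc (suc k)))))
        ≡⟨ Hankel₀-suc-double-suc (suc (suc k)) ⟩
      Hankel 0 (4 ℕ.+ k) * Hankel 1 (3 ℕ.+ k) - Hankel 2 (3 ℕ.+ k) * Hankel 3 (2 ℕ.+ k)
        ≡⟨ sub-*-cong (Hankel 0 (4 ℕ.+ k)) (Hankel 2 (3 ℕ.+ k)) (Hankel₁[4N+3] N) (Hankel₃[4N+2] N) ⟩
      Hankel 0 (4 ℕ.+ k) * 1ℤ - Hankel 2 (3 ℕ.+ k) * - 1ℤ
        ≡⟨ cong₂ (λ a c → a * 1ℤ - c * - 1ℤ) A[4N+4] (Hankel₂-suc-double (suc m)) ⟩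
      (a * (- s) - c * 0ℤ) * 1ℤ - (Hankel 1 (2 ℕ.+ m) * c) * - 1ℤ
        ≡⟨ cong (λ b → (a * (- s) - c * 0ℤ) * 1ℤ - (b * c) * - 1ℤ) B[2N+2] ⟩
      (a * (- s) - c * 0ℤ) * 1ℤ - ((- s) * c) * - 1ℤ
        ≡⟨ simplify a c s ⟩
      a * (- s) - c * s
        ≡⟨ sym A[4N+3] ⟩
      Hankel 0 (3 ℕ.+ k) ∎
      where
      open ≡-Reasoning
      m = double N
      s = sgn N
      a = Hankel 0 (2 ℕ.+ m)
      c = Hankel 2 (suc m)
      B[2N+2] : Hankel 1 (2 ℕ.+ m) ≡ - s
      B[2N+2] = trans (Hankel₁-double≡sgn (suc N)) (sgn-suc N)
      A[4N+4] : Hankel 0 (4 ℕ.+ k) ≡ a * (- s) - c * 0ℤ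
      A[4N+4] = trans (Hankel₀-double-suc (suc m))
                      (sub-*-cong a c B[2N+2] (Hankel₃-suc-double N))
      A[4N+3] : Hankel 0 (3 ℕ.+ k) ≡ a * (- s) - c * s
      A[4N+3] = trans (Hankel₀-suc-double-suc m)
                      (sub-*-cong a c (Hankel₁-suc-double≡-sgn N) (Hankel₃-double≡sgn N))
      simplify : ∀ (a c s : ℤ) → (a * (- s) - c * 0ℤ) * 1ℤ - ((- s) * c) * - 1ℤ ≡ a * (- s) - c * s
      simplify = solve-∀

  module _ (n : ℕ) where
    private
      N = suc n
      k = double (double N)
      -- 4N - 1
      y = odd (suc (double n))

    Hankel₀[8n+8] : Hankel 0 (double k) ≡ Hankel 0 k
    Hankel₀[8n+8] = begin
      Hankel 0 (double (suc y))
        ≡⟨ Hankel₀-double-suc y ⟩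
      Hankel 0 k * Hankel 1 k - Hankel 2 y * Hankel 3 y
        ≡⟨ sub-*-cong (Hankel 0 k) (Hankel 2 y) (Hankel₁[4N] N) (Hankel₃-suc-double (suc (double n))) ⟩
      Hankel 0 k * 1ℤ - Hankel 2 y * 0ℤ
        ≡⟨ simplify (Hankel 0 k) (Hankel 2 y) ⟩
      Hankel 0 k ∎
      where
      open ≡-Reasoning
      simplify : ∀ (a c : ℤ) → a * 1ℤ - c * 0ℤ ≡ a
      simplify = solve-∀

    Hankel₀[8n+9] : Hankel 0 (1 ℕ.+ double k) ≡ Hankel 0 (1 ℕ.+ k)
    Hankel₀[8n+9] = begin
      Hankel 0 (suc (double (suc y)))
        ≡⟨ Hankel₀-suc-double-suc y ⟩
      Hankel 0 (suc k) * Hankel 1 k - Hankel 2 k * Hankel 3 y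
        ≡⟨ sub-*-cong (Hankel 0 (suc k)) (Hankel 2 k) (Hankel₁[4N] N) (Hankel₃-suc-double (suc (double n))) ⟩
      Hankel 0 (suc k) * 1ℤ - Hankel 2 k * 0ℤ
        ≡⟨ simplify (Hankel 0 (suc k)) (Hankel 2 k) ⟩
      Hankel 0 (suc k) ∎
      where
      open ≡-Reasoning
      simplify : ∀ (a c : ℤ) → a * 1ℤ - c * 0ℤ ≡ a
      simplify = solve-∀

    Hankel₀[8n+10] : Hankel 0 (2 ℕ.+ double k) ≡ Hankel 0 (2 ℕ.+ k)
    Hankel₀[8n+10] = begin
      Hankel 0 (double (suc k))
        ≡⟨ Hankel₀-double-suc k ⟩
      Hankel 0 (suc k) * Hankel 1 (suc k) - Hankel 2 k * Hankel 3 k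
        ≡⟨ sub-*-cong (Hankel 0 (suc k)) (Hankel 2 k) (Hankel₁[4N+1] N) (Hankel₃[4N] N) ⟩
      Hankel 0 (suc k) * - 1ℤ - Hankel 2 k * 1ℤ
        ≡⟨ cong₂ (λ a c → a * - 1ℤ - c * 1ℤ) A[4N+1] (Hankel₂-double m) ⟩
      (a * s - c * 0ℤ) * - 1ℤ - Hankel 1 m * c * 1ℤ
        ≡⟨ cong (λ b → (a * s - c * 0ℤ) * - 1ℤ - b * c * 1ℤ) (Hankel₁-double≡sgn N) ⟩
      (a * s - c * 0ℤ) * - 1ℤ - s * c * 1ℤ
        ≡⟨ simplify a c s ⟩
      a * (- s) - c * s
        ≡⟨ sym A[4N+2] ⟩
      Hankel 0 (2 ℕ.+ k) ∎
      where
      open ≡-Reasoning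
      m = double N
      s = sgn N
      a = Hankel 0 (suc m)
      c = Hankel 2 m
      A[4N+1] : Hankel 0 (suc k) ≡ a * s - c * 0ℤ
      A[4N+1] = trans (Hankel₀-suc-double-suc (odd n))
                      (sub-*-cong a c (Hankel₁-double≡sgn N) (Hankel₃-suc-double n))
      A[4N+2] : Hankel 0 (2 ℕ.+ k) ≡ a * (- s) - c * s
      A[4N+2] = trans (Hankel₀-double-suc m)
                      (sub-*-cong a c (Hankel₁-suc-double≡-sgn N) (Hankel₃-double≡sgn N))
      simplify : ∀ (a c s : ℤ) → (a * s - c * 0ℤ) * - 1ℤ - s * c * 1ℤ ≡ a * (- s) - c * s
      simplify = solve-∀

  Hankel₀[8N] : ∀ N → Hankel 0 (double (double (double N))) ≡ Hankel 0 (double (double N))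
  Hankel₀[8N] zero    = refl
  Hankel₀[8N] (suc n) = Hankel₀[8n+8] n

  Hankel₀[8N+1] : ∀ N → Hankel 0 (1 ℕ.+ double (double (double N))) ≡ Hankel 0 (1 ℕ.+ double (double N))
  Hankel₀[8N+1] zero    = refl
  Hankel₀[8N+1] (suc n) = Hankel₀[8n+9] n

  Hankel₀[8N+2] : ∀ N → Hankel 0 (2 ℕ.+ double (double (double N))) ≡ Hankel 0 (2 ℕ.+ double (double N))
  Hankel₀[8N+2] zero    = refl
  Hankel₀[8N+2] (suc n) = Hankel₀[8n+10] n

open import Defs
open import Data.Nat using (ℕ; _*_; _+_)
open import Data.Nat.Properties using (+-comm; +-identityʳ)
open import Data.Nat.Tactic.RingSolver using (solve-∀)
open import Data.Integer using (+_; -_)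
open import Data.Product using (_×_; _,_)
open import Relation.Binary.PropositionalEquality using (_≡_; refl; sym; trans; cong; subst₂)
open HankelDeterminants

h-shift : ∀ {m} x → m ≡ x → ∀ j → h (m + j) ≡ Hankel 0 (j + x)
h-shift {m} x refl j = trans (cong h (+-comm m j)) (h≡Hankel (j + x))

4*≡double² : ∀ n → 4 * n ≡ double (double n)
4*≡double² n = trans (regroup n) (trans (cong (2 *_) (2*≡double n)) (2*≡double (double n)))
  where
  regroup : ∀ n → 4 * n ≡ 2 * (2 * n)
  regroup = solve-∀

8*≡double³ : ∀ n → 8 * n ≡ double (double (double n))
8*≡double³ n = trans (regroup n) (trans (cong (2 *_) (4*≡double² n)) (2*≡double (double (double n))))
  where
  regroup : ∀ n → 8 * n ≡ 2 * (4 * n)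
  regroup = solve-∀

h[8n+j] : ∀ n j → h (8 * n + j) ≡ Hankel 0 (j + double (double (double n)))
h[8n+j] n = h-shift _ (8*≡double³ n)

h[4n+j] : ∀ n j → h (4 * n + j) ≡ Hankel 0 (j + double (double n))
h[4n+j] n = h-shift _ (4*≡double² n)

theorem24 : (h 0 ≡ + 1) × (h 1 ≡ + 1) × (h 2 ≡ - (+ 2))
    × (∀ (n : ℕ) →
    (h (8 * n) ≡ h (4 * n))
    × (h (8 * n + 1) ≡ h (4 * n + 1))
    × (h (8 * n + 2) ≡ h (4 * n + 2))
    × (h (8 * n + 3) ≡ - ((h (4 * n + 2)) ⁺))
    × (h (8 * n + 4) ≡ - h (4 * n + 2))
    × (h (8 * n + 5) ≡ - h (4 * n + 3))
    × (h (8 * n + 6) ≡ (h (4 * n + 3)) ⁺)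
    × (h (8 * n + 7) ≡ h (4 * n + 3)))
theorem24 = refl , refl , refl , λ n →
  subst₂ (λ a b → h a ≡ h b) (+-identityʳ (8 * n)) (+-identityʳ (4 * n)) (transfer n 0 0 (Hankel₀[8N] n)) ,
  transfer n 1 1 (Hankel₀[8N+1] n) ,
  transfer n 2 2 (Hankel₀[8N+2] n) ,
  trans (h[8n+j] n 3) (trans (Hankel₀[8N+3] n) (cong (λ x → - (x ⁺)) (sym (h[4n+j] n 2)))) ,
  trans (h[8n+j] n 4) (trans (Hankel₀[8N+4] n) (cong -_ (sym (h[4n+j] n 2)))) ,
  trans (h[8n+j] n 5) (trans (Hankel₀[8N+5] n) (cong -_ (sym (h[4n+j] n 3)))) ,
  trans (h[8n+j] n 6) (trans (Hankel₀[8N+6] n) (cong _⁺ (sym (h[4n+j] n 3)))) ,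
  transfer n 7 3 (Hankel₀[8N+7] n)
  where
  transfer : ∀ n i j → Hankel 0 (i + double (double (double n))) ≡ Hankel 0 (j + double (double n)) →
             h (8 * n + i) ≡ h (4 * n + j)
  transfer n i j eq = trans (h[8n+j] n i) (trans eq (sym (h[4n+j] n j)))
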